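{- Let $\epsilon_1,\dots,\epsilon_n\in\{*,0,1,2,\dots\}$ be such that $(L_q^{\epsilon_1},\dots,L_q^{\epsilon_n})$ is a lattice word. Then $K^q_n(L_q^{\epsilon_1},\dots,L_q^{\epsilon_n})=0$ unless $\epsilon_1=\dots=\epsilon_{n-1}=*$ and $\epsilon_n=n-1$. In the latter case $$K^q_n(L_q^*,\dots,L_q^*,L_q^{n-1})=\rho\big(L_q^*L_q^*\cdots L_q^*L_q^{n-1}\big)=[n-1]_q!.$$
   Context: Fix $q$ with $-1\le q\le 1$. Let $\mathcal H$ be a complex Hilbert space with orthonormal basis $(e_i)_{i\ge0}$. On the algebraic full Fock space $\mathbb C\Omega\oplus\bigoplus_{n\ge1}\mathcal H^{\otimes n}$ define $P^q_n(\eta_1\otimes\cdots\otimes\eta_n)=\sum_{\sigma\in\mathfrak S_n}q^{\mathrm{inv}(\sigma)}\eta_{\sigma^{ -1}(1)}\otimes\cdots\otimes\eta_{\sigma^{ -1}(n)}$ ($\mathrm{inv}$ = number of inversions) and $\langle\xi,\eta\rangle_q=\delta_{m,n}\langle\xi,P_n^q\eta\rangle$ for $\xi\in\mathcal H^{\otimes m},\eta\in\mathcal H^{\otimes n}$; the $q$-Fock space $\mathcal F_q(\mathcal H)$ is the completion (after dividing out null vectors). Creation operators $L_q(\xi)\Omega=\xi$, $L_q(\xi)\eta_1\otimes\cdots\otimes\eta_n=\xi\otimes\eta_1\otimes\cdots\otimes\eta_n$; annihilation operators $L_q^*(\xi)\Omega=0$, $L^*_q(\xi)\eta_1\otimes\cdots\otimes\eta_n=\sum_{k=1}^nq^{k-1}\langle\xi,\eta_k\rangle\eta_1\otimes\cdots\widehat{\eta_k}\cdots\otimes\eta_n$.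 The state is $\rho(X)=\langle\Omega,X\Omega\rangle_q$. Let $L_q=L_q(e_0)$; for $X$ in the $*$-algebra generated by $L_q$ and $k\ge1$, $X^{(k)}$ is obtained by replacing $L_q(e_0)$ by $L_q(e_k)$ (and $L_q^*(e_0)$ by $L_q^*(e_k)$). For $\pi\in\Pi_n$ (set partitions of $[n]$, viewed as maps to block numbers) $\rho_\pi(X_1,\dots,X_n)=\rho(X_1^{(\pi(1))}\cdots X_n^{(\pi(n))})$, $K^q_\pi=\sum_{\sigma\le\pi}\rho_\sigma\mu(\sigma,\pi)$ ($\mu$ Möbius function of refinement order), $K^q_n=K^q_{\hat1_n}$. Notation: $L_q^0=I$, $L_q^*$ the adjoint, $L_q^k$ the power; $[m]_q=1+q+\dots+q^{m-1}$, $[m]_q!=[1]_q\cdots[m]_q$. Counting $*$ as $-1$, $(L_q^{\epsilon_1},\dots,L_q^{\epsilon_n})$ is a lattice word if $y_j=\epsilon_{j+1}+\dots+\epsilon_n\ge0$ for all $j$ and $y_0=0$. -}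

module Defs where

open import Level using (Level)
open import Data.Bool using (Bool; true; false; if_then_else_; _∧_; _∨_; not)
open import Data.Nat using (ℕ; zero; suc; _≡ᵇ_)
open import Data.Integer using (ℤ; +_; -[1+_]; _≤_) renaming (_+_ to _+ℤ_)
open import Data.List using (List; []; _∷_; _++_; map; concatMap; concat; zipWith; zip; replicate; length; upTo; filter; tails; foldr)
open import Data.Bool.ListAction using (and)
open import Data.List.Relation.Unary.All using (All)
open import Data.Product using (_×_; _,_; proj₁; proj₂)
open import Relation.Binary.PropositionalEquality using (_≡_)
open import Algebra.Bundles using (CommutativeRing)

data Eps : Set where
  star : Eps
  pow  : ℕ → Eps

weight : Eps → ℤ
weight star    = -[1+ 0 ]
weight (pow m) = + m

wsum : List Eps → ℤ
wsum []       = + 0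
wsum (e ∷ es) = weight e +ℤ wsum es

LatticeWord : List Eps → Set
LatticeWord es = All (λ t → + 0 ≤ wsum t) (tails es) × wsum es ≡ + 0

-- Set partitions of [n], encoded canonically as restricted growth strings
-- (block numbers 0,1,2,... in order of first appearance).
genRGS : ℕ → ℕ → List (List ℕ)
genRGS zero    m = [] ∷ []
genRGS (suc r) m =
  concatMap (λ v → map (v ∷_) (genRGS r (if v ≡ᵇ m then suc m else m))) (upTo (suc m))

partitions : ℕ → List (List ℕ)
partitions n = genRGS n 0

top : ℕ → List ℕ
top n = replicate n 0

refinesB : List ℕ → List ℕ → Bool
refinesB σ π =
  let ps = zip σ π in
  and (concatMap (λ a → map (λ b → not (proj₁ a ≡ᵇ proj₁ b) ∨ (proj₂ a ≡ᵇ proj₂ b)) ps) ps)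

eqPB : List ℕ → List ℕ → Bool
eqPB σ π = refinesB σ π ∧ refinesB π σ

-- Letters: creation / annihilation operators on basis vector e_c
data Letter : Set where
  cre : ℕ → Letter
  ann : ℕ → Letter

-- L_q^{ε} with e_0 replaced by e_k, as a word in letters
letters : ℕ → Eps → List Letter
letters k star    = ann k ∷ []
letters k (pow m) = replicate m (cre k)

module Fock {c ℓ : Level} (R : CommutativeRing c ℓ) (q : CommutativeRing.Carrier R) where
  open CommutativeRing R

  sumR : List Carrier → Carrier
  sumR = foldr _+_ 0#

  -- vectors of the algebraic full Fock space: formal combinations of
  -- elementary tensors e_{c1} ⊗ ... ⊗ e_{cn} (word [] = Ω)
  Vect : Set c
  Vect = List (Carrier × List ℕ)

  Ω : Vect
  Ω = (1# , []) ∷ []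

  -- L_q^*(e_c) on a basis tensor: Σ_k q^{k-1} ⟨e_c, e_{d_k}⟩ (remove k-th factor)
  annW : ℕ → List ℕ → Vect
  annW c []      = []
  annW c (d ∷ w) =
    (if c ≡ᵇ d then (1# , w) ∷ [] else [])
    ++ map (λ p → (q * proj₁ p , d ∷ proj₂ p)) (annW c w)

  applyLetter : Letter → Vect → Vect
  applyLetter (cre c) v = map (λ p → (proj₁ p , c ∷ proj₂ p)) v
  applyLetter (ann c) v =
    concatMap (λ p → map (λ r → (proj₁ p * proj₁ r , proj₂ r)) (annW c (proj₂ p))) v

  -- apply the product l₁ l₂ ⋯ l_k (rightmost first)
  applyWord : List Letter → Vect → Vect
  applyWord []       v = v
  applyWord (l ∷ ls) v = applyLetter l (applyWord ls v)

  -- ⟨Ω, ξ⟩_q = coefficient of Ω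
  vac : Vect → Carrier
  vac []                  = 0#
  vac ((a , []) ∷ v)      = a + vac v
  vac ((a , _ ∷ _) ∷ v)   = vac v

  ρ : List Letter → Carrier
  ρ w = vac (applyWord w Ω)

  ρword : List Eps → Carrier
  ρword es = ρ (concat (map (letters 0) es))

  -- ρ_π(L^{ε₁},…,L^{εₙ}) = ρ(X₁^{(π(1))} ⋯ Xₙ^{(π(n))}), block numbers 1,2,...
  ρπ : List ℕ → List Eps → Carrier
  ρπ π es = ρ (concat (zipWith (λ b e → letters (suc b) e) π es))

  -- The fuel bounds the chain length (≤ n suffices for partitions of [n]).
  μ : ℕ → List (List ℕ) → List ℕ → List ℕ → Carrier
  μ zero     ps σ π = if eqPB σ π then 1# else 0#
  μ (suc f)  ps σ π =
    if eqPB σ π then 1#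
    else if refinesB σ π
      then - sumR (map (μ f ps σ)
                (filter (λ τ → Data.Bool.T? (refinesB σ τ ∧ refinesB τ π ∧ not (eqPB τ π))) ps))
      else 0#

  Kπ : List ℕ → List Eps → Carrier
  Kπ π es =
    let n = length es ; ps = partitions n in
    sumR (map (λ σ → if refinesB σ π then ρπ σ es * μ n ps σ π else 0#) ps)

  K : List Eps → Carrier
  K es = Kπ (top (length es)) es

  qpow : ℕ → Carrier
  qpow zero    = 1#
  qpow (suc i) = q * qpow i

  qint : ℕ → Carrier
  qint m = sumR (map qpow (upTo m))

  qfact : ℕ → Carrier
  qfact zero    = 1#
  qfact (suc m) = qfact m * qint (suc m)

-- the exceptional word (L^*, …, L^*, L^{m}) with m stars (n = m+1 entries)
special : ℕ → List Eps
special m = replicate m star ++ (pow m ∷ [])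

-- Expanding ρ_σ(L^{ε₁},…,L^{εₙ}) Wick-style, each L* must annihilate a factor created by one of the
-- powers, so ρ_σ is a sum over attachments cs of every star to a power (each power attached to
-- itself), an attachment contributing exactly when its induced partition is finer than σ.
-- Möbius inversion then collapses K_n = Σ_σ ρ_σ μ(σ, 1̂) to the attachments whose partition is 1̂.
-- Distinct powers lie in distinct blocks, and a lattice word other than (L*,…,L*,L^{n-1}) has two
-- powers, so K_n vanishes; for the exceptional word the only attachment joins everything, and
-- annihilating L^{n-1}Ω factor by factor produces [n-1]_q!.

module Submission where

open import Defs
open import Level using (Level)
open import Data.Nat using (ℕ; _≤_)
open import Data.List using (List; length)
open import Data.Product using (_×_; _,_; ∃)
open import Relation.Nullary using (¬_)
open import Relation.Binary.PropositionalEquality using (_≡_)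
open import Algebra.Bundles using (CommutativeRing)

module Booleans where

  open import Data.Nat using (_≡ᵇ_)
  open import Data.Nat.Properties using (≡⇒≡ᵇ)
  open import Data.Bool using (Bool; true; false; T; _∧_; not)
  open import Data.Bool.Properties using (T-≡; T-∧)
  open import Data.Bool.ListAction using (and)
  open import Data.List using (List; []; _∷_)
  open import Data.List.Relation.Unary.All using (All; []; _∷_)
  open import Data.Product using (_×_; _,_)
  open import Data.Empty using (⊥-elim)
  open import Function.Bundles using (Equivalence)
  open import Relation.Binary.PropositionalEquality

  T-ext : ∀ a b → (T a → T b) → (T b → T a) → a ≡ b
  T-ext false false _   _   = refl
  T-ext false true  _   b⇒a = ⊥-elim (b⇒a _)
  T-ext true  false a⇒b _   = ⊥-elim (a⇒b _)
  T-ext true  true  _   _   = refl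

  T-and⁻ : ∀ bs → T (and bs) → All T bs
  T-and⁻ []          _ = []
  T-and⁻ (true ∷ bs) t = _ ∷ T-and⁻ bs t

  T-and⁺ : ∀ {bs} → All T bs → T (and bs)
  T-and⁺ []                   = _
  T-and⁺ {true ∷ _} (_ ∷ ts) = T-and⁺ ts

  ∧-intro : ∀ {a b} → T a → T b → T (a ∧ b)
  ∧-intro a b = Equivalence.from T-∧ (a , b)

  ∧-elim : ∀ a {b} → T (a ∧ b) → T a × T b
  ∧-elim a = Equivalence.to T-∧

  T-not⁻ : ∀ b → T (not b) → ¬ T b
  T-not⁻ true  () _
  T-not⁻ false _  ()

  T-not⁺ : ∀ b → ¬ T b → T (not b)
  T-not⁺ true  ¬b = ¬b _
  T-not⁺ false _  = _

  ≡ᵇ-refl : ∀ k → (k ≡ᵇ k) ≡ true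
  ≡ᵇ-refl k = Equivalence.to T-≡ (≡⇒≡ᵇ k k refl)

module Counting where

  open import Data.Nat using (ℕ; zero; suc; _+_; _<_; _≤_; z≤n; s≤s; _≡ᵇ_)
  open import Data.Nat.Properties
  open import Data.Nat.ListAction using (sum)
  open import Data.Nat.ListAction.Properties using (sum-++)
  open import Data.Bool using (Bool; true; false; T; if_then_else_)
  open import Data.List using (List; []; _∷_; _++_; map; concatMap; length; upTo)
  import Data.List.Properties as List
  open import Data.List.Relation.Unary.All using (All; []; _∷_)
  open import Data.List.Relation.Unary.Any using (Any; here; there)
  open import Data.Product using (_×_; _,_)
  open import Data.Empty using (⊥-elim)
  open import Function using (id; _∘_)
  open import Relation.Binary.PropositionalEquality
  open import Relation.Nullary using (¬_; yes; no)

  length-∷ʳ : {A : Set} (xs : List A) (x : A) → length (xs ++ x ∷ []) ≡ suc (length xs)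
  length-∷ʳ xs x = trans (List.length-++ xs) (+-comm (length xs) 1)

  countᵇ : {a : Level} {A : Set a} → (A → Bool) → List A → ℕ
  countᵇ P []       = 0
  countᵇ P (x ∷ xs) = (if P x then 1 else 0) + countᵇ P xs

  countᵇ-++ : {A : Set} (P : A → Bool) (xs ys : List A) → countᵇ P (xs ++ ys) ≡ countᵇ P xs + countᵇ P ys
  countᵇ-++ P []       ys = refl
  countᵇ-++ P (x ∷ xs) ys =
    trans (cong ((if P x then 1 else 0) +_) (countᵇ-++ P xs ys)) (sym (+-assoc (if P x then 1 else 0) _ _))

  countᵇ-concatMap : {A B : Set} (P : B → Bool) (f : A → List B) (xs : List A) →
    countᵇ P (concatMap f xs) ≡ sum (map (countᵇ P ∘ f) xs)
  countᵇ-concatMap P f []       = refl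
  countᵇ-concatMap P f (x ∷ xs) =
    trans (countᵇ-++ P (f x) (concatMap f xs)) (cong (countᵇ P (f x) +_) (countᵇ-concatMap P f xs))

  countᵇ-map : {A B : Set} (P : B → Bool) (f : A → B) (xs : List A) → countᵇ P (map f xs) ≡ countᵇ (P ∘ f) xs
  countᵇ-map P f []       = refl
  countᵇ-map P f (x ∷ xs) = cong ((if P (f x) then 1 else 0) +_) (countᵇ-map P f xs)

  countᵇ-cong : {A : Set} {P Q : A → Bool} → (∀ x → P x ≡ Q x) → (xs : List A) → countᵇ P xs ≡ countᵇ Q xs
  countᵇ-cong P≗Q []       = refl
  countᵇ-cong P≗Q (x ∷ xs) = cong₂ (λ b k → (if b then 1 else 0) + k) (P≗Q x) (countᵇ-cong P≗Q xs)

  sum-upTo-suc : ∀ (f : ℕ → ℕ) k → sum (map f (upTo (suc k))) ≡ sum (map f (upTo k)) + f k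
  sum-upTo-suc f k = begin
    sum (map f (upTo (suc k)))              ≡⟨ cong (sum ∘ map f) (sym (List.applyUpTo-∷ʳ id k)) ⟩
    sum (map f (upTo k ++ k ∷ []))          ≡⟨ cong sum (List.map-++ f (upTo k) (k ∷ [])) ⟩
    sum (map f (upTo k) ++ f k ∷ [])        ≡⟨ sum-++ (map f (upTo k)) (f k ∷ []) ⟩
    sum (map f (upTo k)) + (f k + 0)        ≡⟨ cong (sum (map f (upTo k)) +_) (+-identityʳ (f k)) ⟩
    sum (map f (upTo k)) + f k              ∎
    where open ≡-Reasoning

  sum-upTo-zero : ∀ (f : ℕ → ℕ) k → (∀ v → v < k → f v ≡ 0) → sum (map f (upTo k)) ≡ 0
  sum-upTo-zero f zero    _  = refl
  sum-upTo-zero f (suc k) f0 = trans (sum-upTo-suc f k)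
    (cong₂ _+_ (sum-upTo-zero f k (λ v v<k → f0 v (m<n⇒m<1+n v<k))) (f0 k ≤-refl))

  sum-upTo-delta : ∀ (f : ℕ → ℕ) v₀ k → v₀ < k → f v₀ ≡ 1 →
    (∀ v → v < k → v ≢ v₀ → f v ≡ 0) → sum (map f (upTo k)) ≡ 1
  sum-upTo-delta f v₀ (suc k) v₀<1+k f1 f0 with v₀ ≟ k
  ... | yes refl = trans (sum-upTo-suc f k)
    (cong₂ _+_ (sum-upTo-zero f k (λ v v<k → f0 v (m<n⇒m<1+n v<k) (<⇒≢ v<k))) f1)
  ... | no v₀≢k  = trans (sum-upTo-suc f k)
    (cong₂ _+_ (sum-upTo-delta f v₀ k (≤∧≢⇒< (≤-pred v₀<1+k) v₀≢k) f1 (λ v v<k → f0 v (m<n⇒m<1+n v<k)))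
               (f0 k ≤-refl (v₀≢k ∘ sym)))

  countᵇ-mono : {A : Set} {P Q : A → Bool} (xs : List A) → All (λ x → T (P x) → T (Q x)) xs →
    countᵇ P xs ≤ countᵇ Q xs
  countᵇ-mono [] [] = z≤n
  countᵇ-mono {P = P} {Q} (x ∷ xs) (P⇒Q ∷ P⇒Qs) with P x | Q x
  ... | true  | true  = s≤s (countᵇ-mono xs P⇒Qs)
  ... | true  | false = ⊥-elim (P⇒Q _)
  ... | false | true  = m≤n⇒m≤1+n (countᵇ-mono xs P⇒Qs)
  ... | false | false = countᵇ-mono xs P⇒Qs

  countᵇ-mono-< : {A : Set} {P Q : A → Bool} (xs : List A) → All (λ x → T (P x) → T (Q x)) xs →
    Any (λ x → T (Q x) × ¬ T (P x)) xs → countᵇ P xs < countᵇ Q xs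
  countᵇ-mono-< {P = P} {Q} (x ∷ xs) (P⇒Q ∷ P⇒Qs) (here (q , ¬p)) with P x | Q x
  ... | true  | _     = ⊥-elim (¬p _)
  ... | false | true  = s≤s (countᵇ-mono xs P⇒Qs)
  countᵇ-mono-< {P = P} {Q} (x ∷ xs) (P⇒Q ∷ P⇒Qs) (there strict) with P x | Q x
  ... | true  | true  = s≤s (countᵇ-mono-< xs P⇒Qs strict)
  ... | true  | false = ⊥-elim (P⇒Q _)
  ... | false | true  = m<n⇒m<1+n (countᵇ-mono-< xs P⇒Qs strict)
  ... | false | false = countᵇ-mono-< xs P⇒Qs strict

  countᵇ-≤-length : {A : Set} (P : A → Bool) (xs : List A) → countᵇ P xs ≤ length xs
  countᵇ-≤-length P []       = z≤n
  countᵇ-≤-length P (x ∷ xs) with P x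
  ... | true  = s≤s (countᵇ-≤-length P xs)
  ... | false = m≤n⇒m≤1+n (countᵇ-≤-length P xs)

  countᵇ-≡ᵇ-absent : ∀ d xs → All (d <_) xs → countᵇ (_≡ᵇ d) xs ≡ 0
  countᵇ-≡ᵇ-absent d []       _            = refl
  countᵇ-≡ᵇ-absent d (x ∷ xs) (d<x ∷ d<xs) with x ≡ᵇ d in eq
  ... | true  = ⊥-elim (<-irrefl (sym (≡ᵇ⇒≡ x d (subst T (sym eq) _))) d<x)
  ... | false = countᵇ-≡ᵇ-absent d xs d<xs

  Indicator : Set → ℕ → Set
  Indicator P k = (P → k ≡ 1) × (¬ P → k ≡ 0)

module SetPartitions where

  open import Data.Nat using (ℕ; zero; suc; _+_; _<_; _≤_; s≤s; _≡ᵇ_)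
  open import Data.Nat.Properties
  open import Data.Bool using (Bool; true; false; T; _∨_; not; if_then_else_)
  open import Data.Bool.Properties using (T-∧)
  open import Data.Bool.ListAction using (and)
  open import Data.List using (List; []; _∷_; _++_; map; concatMap; zip; length; applyUpTo; upTo)
  open import Data.Nat.ListAction using (sum)
  import Data.List.Properties as List
  open import Data.List.Relation.Unary.All as All using (All; []; _∷_)
  import Data.List.Relation.Unary.Any.Properties as Any
  import Data.List.Relation.Unary.All.Properties as All
  open import Data.Product using (_×_; _,_; proj₁; proj₂; ∃)
  open import Data.Sum using (_⊎_; inj₁; inj₂)
  open import Data.Empty using (⊥-elim)
  open import Function using (id; _∘_)
  open import Function.Bundles using (Equivalence)
  open import Relation.Binary.PropositionalEquality
  open import Relation.Binary.Definitions using (tri<; tri≈; tri>)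
  open import Relation.Nullary using (¬_; yes; no; does)
  open Booleans
  open Counting

  at : List ℕ → ℕ → ℕ
  at []       _       = 0
  at (x ∷ xs) zero    = x
  at (x ∷ xs) (suc i) = at xs i

  at-++ˡ : ∀ p ρ i → i < length p → at (p ++ ρ) i ≡ at p i
  at-++ˡ (x ∷ p) ρ zero    _         = refl
  at-++ˡ (x ∷ p) ρ (suc i) (s≤s i<p) = at-++ˡ p ρ i i<p

  at-++-length : ∀ p v ρ → at (p ++ v ∷ ρ) (length p) ≡ v
  at-++-length []      v ρ = refl
  at-++-length (x ∷ p) v ρ = at-++-length p v ρ

  -- Partitions of {0,…,n-1} are given by block labels; Finer is refinement of their level sets.
  Finer : ℕ → (ℕ → ℕ) → (ℕ → ℕ) → Set
  Finer n f g = ∀ i j → i < n → j < n → f i ≡ f j → g i ≡ g j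

  SameBlocks : ℕ → (ℕ → ℕ) → (ℕ → ℕ) → Set
  SameBlocks n f g = Finer n f g × Finer n g f

  Finer-trans : ∀ {n f g h} → Finer n f g → Finer n g h → Finer n f h
  Finer-trans f⊑g g⊑h i j i<n j<n = g⊑h i j i<n j<n ∘ f⊑g i j i<n j<n

  module _ {A : Set} (g : A → A → Bool) (h : ℕ → A) (n : ℕ) where

    private
      xs = applyUpTo h n

    T-and-allPairs⁻ : T (and (concatMap (λ a → map (g a) xs) xs)) →
      ∀ i j → i < n → j < n → T (g (h i) (h j))
    T-and-allPairs⁻ t i j i<n j<n =
      All.applyUpTo⁻ h n (All.map⁻ (All.applyUpTo⁻ h n (All.map⁻ (All.concat⁻ (T-and⁻ _ t))) i<n)) j<n

    T-and-allPairs⁺ : (∀ i j → i < n → j < n → T (g (h i) (h j))) →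
      T (and (concatMap (λ a → map (g a) xs) xs))
    T-and-allPairs⁺ f = T-and⁺ (All.concat⁺ (All.map⁺ (All.applyUpTo⁺₁ h n
      (λ {i} i<n → All.map⁺ (All.applyUpTo⁺₁ h n (λ {j} j<n → f i j i<n j<n))))))

  kernelTest : ℕ × ℕ → ℕ × ℕ → Bool
  kernelTest a b = not (proj₁ a ≡ᵇ proj₁ b) ∨ (proj₂ a ≡ᵇ proj₂ b)

  kernelTest⁻ : ∀ x x′ y y′ → T (kernelTest (x , y) (x′ , y′)) → x ≡ x′ → y ≡ y′
  kernelTest⁻ x x′ y y′ t x≡x′ with x ≡ᵇ x′ | ≡⇒≡ᵇ x x′ x≡x′
  ... | true | _ = ≡ᵇ⇒≡ y y′ t

  kernelTest⁺ : ∀ x x′ y y′ → (x ≡ x′ → y ≡ y′) → T (kernelTest (x , y) (x′ , y′))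
  kernelTest⁺ x x′ y y′ f with x ≡ᵇ x′ in eq
  ... | false = _
  ... | true  = ≡⇒≡ᵇ y y′ (f (≡ᵇ⇒≡ x x′ (subst T (sym eq) _)))

  zip-as-applyUpTo : ∀ n σ π → length σ ≡ n → length π ≡ n →
    zip σ π ≡ applyUpTo (λ i → at σ i , at π i) n
  zip-as-applyUpTo zero    []      []      _  _  = refl
  zip-as-applyUpTo (suc n) (x ∷ σ) (y ∷ π) lσ lπ =
    cong ((x , y) ∷_) (zip-as-applyUpTo n σ π (suc-injective lσ) (suc-injective lπ))

  module _ {n} (σ π : List ℕ) (lσ : length σ ≡ n) (lπ : length π ≡ n) where

    private
      T-allPairs : List (ℕ × ℕ) → Set
      T-allPairs ps = T (and (concatMap (λ a → map (kernelTest a) ps) ps))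

      zipped = zip-as-applyUpTo n σ π lσ lπ

    refinesB⇒Finer : T (refinesB σ π) → Finer n (at σ) (at π)
    refinesB⇒Finer t i j i<n j<n =
      kernelTest⁻ _ _ _ _
        (T-and-allPairs⁻ kernelTest (λ i → at σ i , at π i) n (subst T-allPairs zipped t) i j i<n j<n)

    Finer⇒refinesB : Finer n (at σ) (at π) → T (refinesB σ π)
    Finer⇒refinesB f = subst T-allPairs (sym zipped)
      (T-and-allPairs⁺ kernelTest (λ i → at σ i , at π i) n
        (λ i j i<n j<n → kernelTest⁺ _ _ _ _ (f i j i<n j<n)))

  eqPB⇒SameBlocks : ∀ {n} σ π → length σ ≡ n → length π ≡ n → T (eqPB σ π) → SameBlocks n (at σ) (at π)
  eqPB⇒SameBlocks σ π lσ lπ t =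
    let (σ≤π , π≤σ) = Equivalence.to T-∧ t in
    refinesB⇒Finer σ π lσ lπ σ≤π , refinesB⇒Finer π σ lπ lσ π≤σ

  SameBlocks⇒eqPB : ∀ {n} σ π → length σ ≡ n → length π ≡ n → SameBlocks n (at σ) (at π) → T (eqPB σ π)
  SameBlocks⇒eqPB σ π lσ lπ (σ⊑π , π⊑σ) =
    Equivalence.from T-∧ (Finer⇒refinesB σ π lσ lπ σ⊑π , Finer⇒refinesB π σ lπ lσ π⊑σ)

  genRGS-length : ∀ r m → All (λ σ → length σ ≡ r) (genRGS r m)
  genRGS-length zero    m = refl ∷ []
  genRGS-length (suc r) m = All.concat⁺ (All.map⁺ (All.applyUpTo⁺₂ id (suc m)
    (λ v → All.map⁺ (All.map (cong suc) (genRGS-length r _)))))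

  partitions-length : ∀ n → All (λ σ → length σ ≡ n) (partitions n)
  partitions-length n = genRGS-length n 0

  IsRGSPrefix : ℕ → List ℕ → ℕ → Set
  IsRGSPrefix k p m = (∀ i → i < k → at p i < m) × (∀ v → v < m → ∃ λ i → i < k × at p i ≡ v)

  nextLabelBound : ℕ → ℕ → ℕ
  nextLabelBound m v = if v ≡ᵇ m then suc m else m

  module _ (p : List ℕ) (v : ℕ) where

    at-∷ʳ-old : ∀ i → i < length p → at (p ++ v ∷ []) i ≡ at p i
    at-∷ʳ-old i = at-++ˡ p (v ∷ []) i

    at-∷ʳ-new : at (p ++ v ∷ []) (length p) ≡ v
    at-∷ʳ-new = at-++-length p v []

    at-∷ʳ-cases : ∀ {i} → i < suc (length p) →
      (i < length p × at (p ++ v ∷ []) i ≡ at p i) ⊎ (i ≡ length p × at (p ++ v ∷ []) i ≡ v)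
    at-∷ʳ-cases {i} i≤p with m≤n⇒m<n∨m≡n (≤-pred i≤p)
    ... | inj₁ i<p  = inj₁ (i<p , at-∷ʳ-old i i<p)
    ... | inj₂ refl = inj₂ (refl , at-∷ʳ-new)

    IsRGSPrefix-∷ʳ : ∀ {m} → IsRGSPrefix (length p) p m → v < suc m →
      IsRGSPrefix (suc (length p)) (p ++ v ∷ []) (nextLabelBound m v)
    IsRGSPrefix-∷ʳ {m} (bounded , surjective) v≤m = bounded′ , surjective′
      where
      bounded′ : ∀ i → i < suc (length p) → at (p ++ v ∷ []) i < nextLabelBound m v
      bounded′ i i≤p with at-∷ʳ-cases i≤p | v ≡ᵇ m in eq
      ... | inj₁ (i<p , e) | true  = subst (_< suc m) (sym e) (m<n⇒m<1+n (bounded i i<p))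
      ... | inj₁ (i<p , e) | false = subst (_< m) (sym e) (bounded i i<p)
      ... | inj₂ (_ , e)   | true  = subst (_< suc m) (sym e) v≤m
      ... | inj₂ (_ , e)   | false =
        subst (_< m) (sym e) (≤∧≢⇒< (≤-pred v≤m) (λ v≡m → subst T eq (≡⇒≡ᵇ v m v≡m)))
      old : ∀ w → w < m → ∃ λ i → i < suc (length p) × at (p ++ v ∷ []) i ≡ w
      old w w<m = let (i , i<p , e) = surjective w w<m in i , m<n⇒m<1+n i<p , trans (at-∷ʳ-old i i<p) e
      surjective′ : ∀ w → w < nextLabelBound m v → ∃ λ i → i < suc (length p) × at (p ++ v ∷ []) i ≡ w
      surjective′ w w< with v ≡ᵇ m in eq
      ... | false = old w w<
      ... | true with m≤n⇒m<n∨m≡n (≤-pred w<)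
      ...   | inj₁ w<m  = old w w<m
      ...   | inj₂ refl = length p , ≤-refl , trans at-∷ʳ-new (≡ᵇ⇒≡ v w (subst T (sym eq) _))

    module _ (g : ℕ → ℕ) where

      SameBlocks-∷ʳ-init : SameBlocks (suc (length p)) (at (p ++ v ∷ [])) g → SameBlocks (length p) (at p) g
      SameBlocks-∷ʳ-init (f⊑g , g⊑f) =
        (λ i j i<p j<p e → f⊑g i j (m<n⇒m<1+n i<p) (m<n⇒m<1+n j<p)
          (trans (at-∷ʳ-old i i<p) (trans e (sym (at-∷ʳ-old j j<p))))) ,
        (λ i j i<p j<p e → trans (sym (at-∷ʳ-old i i<p))
          (trans (g⊑f i j (m<n⇒m<1+n i<p) (m<n⇒m<1+n j<p) e) (at-∷ʳ-old j j<p)))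

      JoinsLast : Set
      JoinsLast = ∀ i → i < length p → (at p i ≡ v → g i ≡ g (length p)) × (g i ≡ g (length p) → at p i ≡ v)

      SameBlocks-∷ʳ-last : SameBlocks (suc (length p)) (at (p ++ v ∷ [])) g → JoinsLast
      SameBlocks-∷ʳ-last (f⊑g , g⊑f) i i<p =
        (λ e → f⊑g i (length p) (m<n⇒m<1+n i<p) ≤-refl (trans (at-∷ʳ-old i i<p) (trans e (sym at-∷ʳ-new)))) ,
        (λ e → trans (sym (at-∷ʳ-old i i<p)) (trans (g⊑f i (length p) (m<n⇒m<1+n i<p) ≤-refl e) at-∷ʳ-new))

      SameBlocks-∷ʳ : SameBlocks (length p) (at p) g → JoinsLast →
        SameBlocks (suc (length p)) (at (p ++ v ∷ [])) g
      SameBlocks-∷ʳ (f⊑g , g⊑f) joins = f⊑g′ , g⊑f′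
        where
        f = at (p ++ v ∷ [])
        f⊑g′ : Finer (suc (length p)) f g
        f⊑g′ i j i≤p j≤p e with at-∷ʳ-cases i≤p | at-∷ʳ-cases j≤p
        ... | inj₁ (i<p , fi) | inj₁ (j<p , fj) = f⊑g i j i<p j<p (trans (sym fi) (trans e fj))
        ... | inj₁ (i<p , fi) | inj₂ (refl , fj) = proj₁ (joins i i<p) (trans (sym fi) (trans e fj))
        ... | inj₂ (refl , fi) | inj₁ (j<p , fj) = sym (proj₁ (joins j j<p) (trans (sym fj) (trans (sym e) fi)))
        ... | inj₂ (refl , _) | inj₂ (refl , _) = refl
        g⊑f′ : Finer (suc (length p)) g f
        g⊑f′ i j i≤p j≤p e with at-∷ʳ-cases i≤p | at-∷ʳ-cases j≤p
        ... | inj₁ (i<p , fi) | inj₁ (j<p , fj) = trans fi (trans (g⊑f i j i<p j<p e) (sym fj))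
        ... | inj₁ (i<p , fi) | inj₂ (refl , fj) = trans fi (trans (proj₂ (joins i i<p) e) (sym fj))
        ... | inj₂ (refl , fi) | inj₁ (j<p , fj) = trans fi (trans (sym (proj₂ (joins j j<p) (sym e))) (sym fj))
        ... | inj₂ (refl , _) | inj₂ (refl , _) = refl

  SameBlocks-∷ʳ-unique : ∀ p m g → IsRGSPrefix (length p) p m → SameBlocks (length p) (at p) g →
    ∃ λ v₀ → v₀ < suc m × (∀ v → v < suc m → SameBlocks (suc (length p)) (at (p ++ v ∷ [])) g → v ≡ v₀)
                        × SameBlocks (suc (length p)) (at (p ++ v₀ ∷ [])) g
  SameBlocks-∷ʳ-unique p m g (bounded , surjective) (f⊑g , g⊑f)
    with anyUpTo? (λ j → g j ≟ g (length p)) (length p)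
  ... | yes (j , j<p , gj) =
    at p j , s≤s (<⇒≤ (bounded j j<p)) ,
    (λ v _ sb → sym (proj₂ (SameBlocks-∷ʳ-last p v g sb j j<p) gj)) ,
    SameBlocks-∷ʳ p (at p j) g (f⊑g , g⊑f) (λ i i<p →
      (λ e → trans (f⊑g i j i<p j<p e) gj) , (λ e → g⊑f i j i<p j<p (trans e (sym gj))))
  ... | no new =
    m , ≤-refl ,
    (λ v v≤m sb → ≤-antisym (≤-pred v≤m) (≮⇒≥ (λ v<m →
      let (j , j<p , e) = surjective v v<m in new (j , j<p , proj₁ (SameBlocks-∷ʳ-last p v g sb j j<p) e)))) ,
    SameBlocks-∷ʳ p m g (f⊑g , g⊑f) (λ i i<p →
      (λ e → ⊥-elim (<-irrefl e (bounded i i<p))) , (λ e → ⊥-elim (new (i , i<p , e))))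

  count-extensions : ∀ r m k p τ → length p ≡ k → IsRGSPrefix k p m → length τ ≡ k + r →
    Indicator (SameBlocks k (at p) (at τ)) (countᵇ (λ ρ → eqPB (p ++ ρ) τ) (genRGS r m))
  count-extensions zero m k p τ refl _ lτ rewrite List.++-identityʳ p with eqPB p τ in eq
  ... | true  = (λ _ → refl) , (λ ¬sb → ⊥-elim (¬sb (eqPB⇒SameBlocks p τ refl lτ′ (subst T (sym eq) _))))
    where lτ′ = trans lτ (+-identityʳ _)
  ... | false = (λ sb → ⊥-elim (subst T eq (SameBlocks⇒eqPB p τ refl lτ′ sb))) , (λ _ → refl)
    where lτ′ = trans lτ (+-identityʳ _)
  count-extensions (suc r) m k p τ refl prefix lτ = one , none
    where
    P : List ℕ → Bool
    P ρ = eqPB (p ++ ρ) τ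
    suffixes : ℕ → List (List ℕ)
    suffixes v = genRGS r (nextLabelBound m v)
    F : ℕ → ℕ
    F v = countᵇ (λ ρ → eqPB ((p ++ v ∷ []) ++ ρ) τ) (suffixes v)
    split : countᵇ P (genRGS (suc r) m) ≡ sum (map F (upTo (suc m)))
    split = trans (countᵇ-concatMap P (λ v → map (v ∷_) (suffixes v)) (upTo (suc m)))
      (cong sum (List.map-cong (λ v → trans (countᵇ-map P (v ∷_) (suffixes v))
        (countᵇ-cong (λ ρ → cong (λ l → eqPB l τ) (sym (List.++-assoc p (v ∷ []) ρ))) (suffixes v))) (upTo (suc m))))
    IH : ∀ v → v < suc m → Indicator (SameBlocks (suc (length p)) (at (p ++ v ∷ [])) (at τ)) (F v)
    IH v v≤m = count-extensions r (nextLabelBound m v) (suc (length p)) (p ++ v ∷ []) τ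
      (length-∷ʳ p v) (IsRGSPrefix-∷ʳ p v prefix v≤m) (trans lτ (+-suc (length p) r))
    one : SameBlocks (length p) (at p) (at τ) → countᵇ P (genRGS (suc r) m) ≡ 1
    one sb = let (v₀ , v₀≤m , unique , sb₀) = SameBlocks-∷ʳ-unique p m (at τ) prefix sb in
      trans split (sum-upTo-delta F v₀ (suc m) v₀≤m (proj₁ (IH v₀ v₀≤m) sb₀)
        (λ v v≤m v≢v₀ → proj₂ (IH v v≤m) (v≢v₀ ∘ unique v v≤m)))
    none : ¬ SameBlocks (length p) (at p) (at τ) → countᵇ P (genRGS (suc r) m) ≡ 0
    none ¬sb = trans split (sum-upTo-zero F (suc m) (λ v v≤m →
      proj₂ (IH v v≤m) (¬sb ∘ SameBlocks-∷ʳ-init p v (at τ))))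

  count-eqPB-partitions : ∀ n τ → length τ ≡ n → countᵇ (λ σ → eqPB σ τ) (partitions n) ≡ 1
  count-eqPB-partitions n τ lτ =
    proj₁ (count-extensions n 0 0 [] τ refl ((λ _ ()) , (λ _ ())) lτ) ((λ _ _ ()) , (λ _ _ ()))

  isFirstInBlock : (ℕ → ℕ) → ℕ → Bool
  isFirstInBlock f i = not (does (anyUpTo? (λ j → f j ≟ f i) i))

  isFirstInBlock⁻ : ∀ f i → T (isFirstInBlock f i) → ∀ j → j < i → f j ≢ f i
  isFirstInBlock⁻ f i t j j<i e with anyUpTo? (λ j → f j ≟ f i) i
  ... | no none = none (j , j<i , e)

  isFirstInBlock⁺ : ∀ f i → (∀ j → j < i → f j ≢ f i) → T (isFirstInBlock f i)
  isFirstInBlock⁺ f i first with anyUpTo? (λ j → f j ≟ f i) i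
  ... | yes (j , j<i , e) = first j j<i e
  ... | no _              = _

  firstInBlock : ∀ f i → ∃ λ a → a ≤ i × f a ≡ f i × T (isFirstInBlock f a)
  firstInBlock f i = go (suc i) i ≤-refl
    where
    go : ∀ fuel i → i < fuel → ∃ λ a → a ≤ i × f a ≡ f i × T (isFirstInBlock f a)
    go (suc fuel) i i<fuel with anyUpTo? (λ j → f j ≟ f i) i
    ... | no none = i , ≤-refl , refl , isFirstInBlock⁺ f i (λ j j<i e → none (j , j<i , e))
    ... | yes (j , j<i , e) =
      let (a , a≤j , fa , first) = go fuel j (≤-trans j<i (≤-pred i<fuel)) in
      a , ≤-trans a≤j (<⇒≤ j<i) , trans fa e , first

  isFirstInBlock-unique : ∀ g a b → T (isFirstInBlock g a) → T (isFirstInBlock g b) → g a ≡ g b → a ≡ b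
  isFirstInBlock-unique g a b a-first b-first ga≡gb with <-cmp a b
  ... | tri< a<b _ _ = ⊥-elim (isFirstInBlock⁻ g b b-first a a<b ga≡gb)
  ... | tri≈ _ a≡b _ = a≡b
  ... | tri> _ _ b<a = ⊥-elim (isFirstInBlock⁻ g a a-first b b<a (sym ga≡gb))

  blockCount : ℕ → (ℕ → ℕ) → ℕ
  blockCount n f = countᵇ (isFirstInBlock f) (upTo n)

  blockCount-≤ : ∀ n f → blockCount n f ≤ n
  blockCount-≤ n f = subst (blockCount n f ≤_) (List.length-upTo n) (countᵇ-≤-length (isFirstInBlock f) (upTo n))

  module _ {n f g} (f⊑g : Finer n f g) where

    isFirstInBlock-Finer : ∀ i → i < n → T (isFirstInBlock g i) → T (isFirstInBlock f i)
    isFirstInBlock-Finer i i<n t =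
      isFirstInBlock⁺ f i (λ j j<i e → isFirstInBlock⁻ g i t j j<i (f⊑g j i (<-trans j<i i<n) i<n e))

    blockCount-≤⇒Finer : blockCount n f ≤ blockCount n g → Finer n g f
    blockCount-≤⇒Finer count≤ i j i<n j<n gi≡gj =
      let (a , a≤i , fa≡fi , a-first) = firstInBlock f i
          (b , b≤j , fb≡fj , b-first) = firstInBlock f j
          a<n = ≤-<-trans a≤i i<n
          b<n = ≤-<-trans b≤j j<n
          ga≡gb = trans (f⊑g a i a<n i<n fa≡fi) (trans gi≡gj (sym (f⊑g b j b<n j<n fb≡fj)))
          a≡b = isFirstInBlock-unique g a b (firstSame a a<n a-first) (firstSame b b<n b-first) ga≡gb
      in trans (sym fa≡fi) (trans (cong f a≡b) fb≡fj)
      where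
      firstSame : ∀ k → k < n → T (isFirstInBlock f k) → T (isFirstInBlock g k)
      firstSame k k<n t with isFirstInBlock g k in eq
      ... | true  = _
      ... | false = ⊥-elim (<⇒≱ (countᵇ-mono-< (upTo n) (All.applyUpTo⁺₁ id n (λ {i} → isFirstInBlock-Finer i))
                      (Any.applyUpTo⁺ id (t , subst T eq) k<n)) count≤)

module RingSums {c ℓ} (R : CommutativeRing c ℓ) where

  open import Data.Nat using (ℕ; _≡ᵇ_)
  open import Data.Nat.Properties using (suc-injective; ≡ᵇ⇒≡)
  open import Data.Bool using (Bool; true; false; T; _∧_; if_then_else_)
  open import Data.List using (List; []; _∷_; _++_; map; concatMap; filter; foldr)
  open import Data.List.Relation.Unary.All using (All; []; _∷_)
  open import Data.Empty using (⊥-elim)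
  import Relation.Binary.PropositionalEquality as ≡
  open import Relation.Nullary using (¬_)
  open import Relation.Nullary.Decidable using (T?)
  open Counting using (countᵇ)

  open CommutativeRing R
  open import Relation.Binary.Reasoning.Setoid setoid
  open import Algebra.Properties.AbelianGroup +-abelianGroup using (⁻¹-∙-comm; ε⁻¹≈ε)

  Σ : {a : Level} {A : Set a} → List A → (A → Carrier) → Carrier
  Σ xs f = foldr _+_ 0# (map f xs)

  ind : Bool → Carrier → Carrier
  ind b x = if b then x else 0#

  module _ {a : Level} {A : Set a} where

    Σ-cong : (xs : List A) {f g : A → Carrier} → (∀ x → f x ≈ g x) → Σ xs f ≈ Σ xs g
    Σ-cong []       f≈g = refl
    Σ-cong (x ∷ xs) f≈g = +-cong (f≈g x) (Σ-cong xs f≈g)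

    Σ-cong-local : (xs : List A) {f g : A → Carrier} → All (λ x → f x ≈ g x) xs → Σ xs f ≈ Σ xs g
    Σ-cong-local []       []           = refl
    Σ-cong-local (x ∷ xs) (fx≈gx ∷ f≈g) = +-cong fx≈gx (Σ-cong-local xs f≈g)

    Σ-zero : (xs : List A) (f : A → Carrier) → All (λ x → f x ≈ 0#) xs → Σ xs f ≈ 0#
    Σ-zero []       f []           = refl
    Σ-zero (x ∷ xs) f (fx≈0 ∷ f≈0) = trans (+-cong fx≈0 (Σ-zero xs f f≈0)) (+-identityˡ 0#)

    Σ-+ : (xs : List A) (f g : A → Carrier) → Σ xs (λ x → f x + g x) ≈ Σ xs f + Σ xs g
    Σ-+ []       f g = sym (+-identityˡ 0#)
    Σ-+ (x ∷ xs) f g = begin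
      (f x + g x) + Σ xs (λ x → f x + g x) ≈⟨ +-congˡ (Σ-+ xs f g) ⟩
      (f x + g x) + (Σ xs f + Σ xs g)      ≈⟨ +-assoc (f x) (g x) _ ⟩
      f x + (g x + (Σ xs f + Σ xs g))      ≈⟨ +-congˡ (sym (+-assoc (g x) _ _)) ⟩
      f x + ((g x + Σ xs f) + Σ xs g)      ≈⟨ +-congˡ (+-congʳ (+-comm (g x) _)) ⟩
      f x + ((Σ xs f + g x) + Σ xs g)      ≈⟨ +-congˡ (+-assoc _ (g x) _) ⟩
      f x + (Σ xs f + (g x + Σ xs g))      ≈⟨ sym (+-assoc (f x) _ _) ⟩
      (f x + Σ xs f) + (g x + Σ xs g)      ∎

    Σ-distribˡ : (xs : List A) (k : Carrier) (f : A → Carrier) → Σ xs (λ x → k * f x) ≈ k * Σ xs f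
    Σ-distribˡ []       k f = sym (zeroʳ k)
    Σ-distribˡ (x ∷ xs) k f = trans (+-congˡ (Σ-distribˡ xs k f)) (sym (distribˡ k (f x) _))

    Σ-distribʳ : (xs : List A) (k : Carrier) (f : A → Carrier) → Σ xs (λ x → f x * k) ≈ Σ xs f * k
    Σ-distribʳ []       k f = sym (zeroˡ k)
    Σ-distribʳ (x ∷ xs) k f = trans (+-congˡ (Σ-distribʳ xs k f)) (sym (distribʳ k (f x) _))

    Σ-neg : (xs : List A) (f : A → Carrier) → Σ xs (λ x → - f x) ≈ - Σ xs f
    Σ-neg []       f = sym ε⁻¹≈ε
    Σ-neg (x ∷ xs) f = trans (+-congˡ (Σ-neg xs f)) (⁻¹-∙-comm (f x) _)

    Σ-++ : (xs ys : List A) (f : A → Carrier) → Σ (xs ++ ys) f ≈ Σ xs f + Σ ys f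
    Σ-++ []       ys f = sym (+-identityˡ _)
    Σ-++ (x ∷ xs) ys f = trans (+-congˡ (Σ-++ xs ys f)) (sym (+-assoc (f x) _ _))

    Σ-filter : (P : A → Bool) (xs : List A) (g : A → Carrier) →
      foldr _+_ 0# (map g (filter (λ x → T? (P x)) xs)) ≈ Σ xs (λ x → ind (P x) (g x))
    Σ-filter P []       g = refl
    Σ-filter P (x ∷ xs) g with P x
    ... | true  = +-congˡ (Σ-filter P xs g)
    ... | false = trans (Σ-filter P xs g) (sym (+-identityˡ _))

    Σ-ind-count₀ : (P : A → Bool) (xs : List A) (g : A → Carrier) → countᵇ P xs ≡.≡ 0 →
      Σ xs (λ x → ind (P x) (g x)) ≈ 0#
    Σ-ind-count₀ P []       g _ = refl
    Σ-ind-count₀ P (x ∷ xs) g e with P x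
    ... | false = trans (+-identityˡ _) (Σ-ind-count₀ P xs g e)

    Σ-ind-count₁ : (P : A → Bool) (xs : List A) (k : Carrier) → countᵇ P xs ≡.≡ 1 →
      Σ xs (λ x → ind (P x) k) ≈ k
    Σ-ind-count₁ P (x ∷ xs) k e with P x
    ... | true  = trans (+-congˡ (Σ-ind-count₀ P xs (λ _ → k) (suc-injective e))) (+-identityʳ k)
    ... | false = trans (+-identityˡ _) (Σ-ind-count₁ P xs k e)

  module _ {a b : Level} {A : Set a} {B : Set b} where

    Σ-map : (g : A → B) (xs : List A) (f : B → Carrier) → Σ (map g xs) f ≡.≡ Σ xs (λ x → f (g x))
    Σ-map g []       f = ≡.refl
    Σ-map g (x ∷ xs) f = ≡.cong (f (g x) +_) (Σ-map g xs f)

    Σ-concatMap : (g : A → List B) (xs : List A) (f : B → Carrier) → Σ (concatMap g xs) f ≈ Σ xs (λ x → Σ (g x) f)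
    Σ-concatMap g []       f = refl
    Σ-concatMap g (x ∷ xs) f = trans (Σ-++ (g x) (concatMap g xs) f) (+-congˡ (Σ-concatMap g xs f))

    Σ-swap : (xs : List A) (ys : List B) (f : A → B → Carrier) →
      Σ xs (λ x → Σ ys (λ y → f x y)) ≈ Σ ys (λ y → Σ xs (λ x → f x y))
    Σ-swap []       ys f = sym (Σ-cong-zero ys)
      where
      Σ-cong-zero : (zs : List B) → Σ zs (λ _ → 0#) ≈ 0#
      Σ-cong-zero []       = refl
      Σ-cong-zero (z ∷ zs) = trans (+-congˡ (Σ-cong-zero zs)) (+-identityˡ 0#)
    Σ-swap (x ∷ xs) ys f = trans (+-congˡ (Σ-swap xs ys f)) (sym (Σ-+ ys (f x) (λ y → Σ xs (λ x → f x y))))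

  ind-cong : (b : Bool) {x y : Carrier} → (T b → x ≈ y) → ind b x ≈ ind b y
  ind-cong true  x≈y = x≈y _
  ind-cong false _   = refl

  ind-zero : ∀ b → ind b 0# ≈ 0#
  ind-zero true  = refl
  ind-zero false = refl

  ind-true : (b : Bool) (x : Carrier) → T b → ind b x ≡.≡ x
  ind-true true x _ = ≡.refl

  ind-false : (b : Bool) (x : Carrier) → ¬ T b → ind b x ≡.≡ 0#
  ind-false true  x ¬b = ⊥-elim (¬b _)
  ind-false false x _  = ≡.refl

  ind-∧ : (a b : Bool) (x : Carrier) → ind a (ind b x) ≡.≡ ind (a ∧ b) x
  ind-∧ true  b x = ≡.refl
  ind-∧ false b x = ≡.refl

  ind-comm : (a b : Bool) (x : Carrier) → ind a (ind b x) ≡.≡ ind b (ind a x)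
  ind-comm true  b     x = ≡.refl
  ind-comm false true  x = ≡.refl
  ind-comm false false x = ≡.refl

  ind-neg : (b : Bool) (x : Carrier) → ind b (- x) ≈ - ind b x
  ind-neg true  x = refl
  ind-neg false x = sym ε⁻¹≈ε

  ind-+ : (b : Bool) (x y : Carrier) → ind b (x + y) ≈ ind b x + ind b y
  ind-+ true  x y = refl
  ind-+ false x y = sym (+-identityˡ 0#)

  ind-*ˡ : (b : Bool) (k x : Carrier) → ind b (k * x) ≈ k * ind b x
  ind-*ˡ true  k x = refl
  ind-*ˡ false k x = sym (zeroʳ k)

  ind-*-swap : (b : Bool) (x y : Carrier) → ind b x * y ≈ x * ind b y
  ind-*-swap true  x y = refl
  ind-*-swap false x y = trans (zeroˡ y) (sym (zeroʳ x))

  ind-Σ : {a : Level} {A : Set a} (b : Bool) (xs : List A) (f : A → Carrier) →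
    ind b (Σ xs f) ≈ Σ xs (λ x → ind b (f x))
  ind-Σ true  xs       f = refl
  ind-Σ false []       f = refl
  ind-Σ false (x ∷ xs) f = trans (sym (+-identityˡ 0#)) (+-congˡ (ind-Σ false xs f))

  Σ-ind-≡ᵇ : (d : ℕ) (xs : List ℕ) → countᵇ (_≡ᵇ d) xs ≡.≡ 1 → (g : ℕ → Carrier) →
    Σ xs (λ p → ind (p ≡ᵇ d) (g p)) ≈ g d
  Σ-ind-≡ᵇ d (x ∷ xs) once g with x ≡ᵇ d in eq
  ... | true rewrite ≡ᵇ⇒≡ x d (≡.subst T (≡.sym eq) _) =
    trans (+-congˡ (Σ-ind-count₀ (_≡ᵇ d) xs g (suc-injective once))) (+-identityʳ _)
  ... | false = trans (+-identityˡ _) (Σ-ind-≡ᵇ d xs once g)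

-- μ is defined inside Fock, so the Möbius identity carries the (unused) parameter q along.
module MöbiusInversion {c ℓ} (R : CommutativeRing c ℓ) (q : CommutativeRing.Carrier R) (n : ℕ) where

  open import Data.Nat using (ℕ; zero; suc; _<_; _≤_) renaming (_+_ to _+ℕ_)
  open import Data.Nat.Properties using (≤-trans; +-suc; +-monoʳ-≤; ≰⇒>)
  open import Data.Bool using (Bool; true; false; T; _∧_; not)
  open import Data.List using (List; length; map; filter; foldr)
  open import Data.List.Relation.Unary.All as All using (All)
  open import Data.Product using (_×_; _,_; proj₂)
  open import Data.Empty using (⊥-elim)
  open import Function using (_∘_)
  import Relation.Binary.PropositionalEquality as ≡
  open import Relation.Nullary using (¬_)
  open import Relation.Nullary.Decidable using (T?)
  open import Defs using () renaming (refinesB to infix 7 _≤ᵇ_; eqPB to infix 7 _≈ᵇ_)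
  open Booleans
  open SetPartitions

  open CommutativeRing R
  open Fock R q using (μ)
  open RingSums R
  open import Relation.Binary.Reasoning.Setoid setoid

  Πₙ : List (List ℕ)
  Πₙ = partitions n

  Len : List ℕ → Set
  Len σ = length σ ≡.≡ n

  ≤ᵇ-trans : ∀ σ π ρ → Len σ → Len π → Len ρ → T (σ ≤ᵇ π) → T (π ≤ᵇ ρ) → T (σ ≤ᵇ ρ)
  ≤ᵇ-trans σ π ρ lσ lπ lρ σ≤π π≤ρ = Finer⇒refinesB σ ρ lσ lρ
    (Finer-trans (refinesB⇒Finer σ π lσ lπ σ≤π) (refinesB⇒Finer π ρ lπ lρ π≤ρ))

  ≈ᵇ-intro : ∀ σ π → T (σ ≤ᵇ π) → T (π ≤ᵇ σ) → T (σ ≈ᵇ π)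
  ≈ᵇ-intro σ π = ∧-intro

  ≈ᵇ-elim : ∀ σ π → T (σ ≈ᵇ π) → T (σ ≤ᵇ π) × T (π ≤ᵇ σ)
  ≈ᵇ-elim σ π = ∧-elim (σ ≤ᵇ π)

  ≤ᵇ-antisym-blockCount : ∀ σ π → Len σ → Len π → T (σ ≤ᵇ π) →
    blockCount n (at σ) ≤ blockCount n (at π) → T (π ≤ᵇ σ)
  ≤ᵇ-antisym-blockCount σ π lσ lπ σ≤π count≤ =
    Finer⇒refinesB π σ lπ lσ (blockCount-≤⇒Finer (refinesB⇒Finer σ π lσ lπ σ≤π) count≤)

  <ᵇ-blockCount : ∀ σ π → Len σ → Len π → T (σ ≤ᵇ π) → ¬ T (π ≤ᵇ σ) →
    blockCount n (at π) < blockCount n (at σ)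
  <ᵇ-blockCount σ π lσ lπ σ≤π π≰σ = ≰⇒> (π≰σ ∘ ≤ᵇ-antisym-blockCount σ π lσ lπ σ≤π)

  Πₙ-length : All Len Πₙ
  Πₙ-length = partitions-length n

  Σ-≈ᵇ : ∀ π → Len π → Σ Πₙ (λ σ → ind (σ ≈ᵇ π) 1#) ≈ 1#
  Σ-≈ᵇ π lπ = Σ-ind-count₁ (_≈ᵇ π) Πₙ 1# (count-eqPB-partitions n π lπ)

  IntervalSum : ℕ → List ℕ → List ℕ → Carrier
  IntervalSum fuel τ π = Σ Πₙ (λ σ → ind (τ ≤ᵇ σ ∧ σ ≤ᵇ π) (μ fuel Πₙ σ π))

  -- σ ≤ ρ < π, literally the filter in the recursion defining μ
  Below : List ℕ → List ℕ → List ℕ → Bool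
  Below π σ ρ = σ ≤ᵇ ρ ∧ ρ ≤ᵇ π ∧ not (ρ ≈ᵇ π)

  module _ (f : ℕ) (τ π : List ℕ) (lτ : Len τ) (lπ : Len π) (τ≤π : T (τ ≤ᵇ π)) (π≰τ : ¬ T (π ≤ᵇ τ))
           (bound : blockCount n (at τ) ≤ suc f +ℕ blockCount n (at π)) where

    private
      S : List ℕ → Carrier
      S σ = foldr _+_ 0# (map (μ f Πₙ σ) (filter (λ ρ → T? (Below π σ ρ)) Πₙ))

      X : List ℕ → List ℕ → Carrier
      X σ ρ = ind (Below π τ ρ) (ind (τ ≤ᵇ σ ∧ σ ≤ᵇ ρ) (μ f Πₙ σ ρ))

      unfold-μ : ∀ σ → Len σ →
        ind (τ ≤ᵇ σ ∧ σ ≤ᵇ π) (μ (suc f) Πₙ σ π) ≈ ind (σ ≈ᵇ π) 1# + ind (Below π τ σ) (- S σ)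
      unfold-μ σ lσ with σ ≈ᵇ π in σ≈π
      ... | true =
        let (σ≤π , π≤σ) = ≈ᵇ-elim σ π (≡.subst T (≡.sym σ≈π) _) in begin
        ind (τ ≤ᵇ σ ∧ σ ≤ᵇ π) 1#    ≡⟨ ind-true _ 1# (∧-intro (≤ᵇ-trans τ π σ lτ lπ lσ τ≤π π≤σ) σ≤π) ⟩
        1#                          ≈⟨ sym (+-identityʳ 1#) ⟩
        1# + 0#                     ≡⟨ ≡.cong (1# +_) (≡.sym (ind-false (τ ≤ᵇ σ ∧ σ ≤ᵇ π ∧ false) _
                                         (λ t → proj₂ (∧-elim (σ ≤ᵇ π) (proj₂ (∧-elim (τ ≤ᵇ σ) t)))))) ⟩
        1# + ind (τ ≤ᵇ σ ∧ σ ≤ᵇ π ∧ false) (- S σ) ∎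
      ... | false with σ ≤ᵇ π
      ...   | true  = sym (+-identityˡ _)
      ...   | false = begin
        ind (τ ≤ᵇ σ ∧ false) 0#                  ≈⟨ ind-zero (τ ≤ᵇ σ ∧ false) ⟩
        0#                                       ≈⟨ sym (+-identityʳ 0#) ⟩
        0# + 0#                                  ≡⟨ ≡.cong (0# +_) (≡.sym (ind-false (τ ≤ᵇ σ ∧ false ∧ true) _
                                                      (proj₂ ∘ ∧-elim (τ ≤ᵇ σ)))) ⟩
        0# + ind (τ ≤ᵇ σ ∧ false ∧ true) (- S σ) ∎

      reindex : ∀ σ ρ → Len σ → Len ρ →
        ind (Below π τ σ) (ind (Below π σ ρ) (μ f Πₙ σ ρ)) ≡.≡ X σ ρ
      reindex σ ρ lσ lρ = ≡.trans (ind-∧ (Below π τ σ) _ _)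
        (≡.trans (≡.cong (λ b → ind b (μ f Πₙ σ ρ)) same) (≡.sym (ind-∧ (Below π τ ρ) _ _)))
        where
        same : (Below π τ σ ∧ Below π σ ρ) ≡.≡ (Below π τ ρ ∧ (τ ≤ᵇ σ ∧ σ ≤ᵇ ρ))
        same = T-ext _ _
          (λ t → let (τσπ , σρπ) = ∧-elim (Below π τ σ) t
                     (τ≤σ , _) = ∧-elim (τ ≤ᵇ σ) τσπ
                     (σ≤ρ , ρ<π) = ∧-elim (σ ≤ᵇ ρ) σρπ in
                 ∧-intro (∧-intro (≤ᵇ-trans τ σ ρ lτ lσ lρ τ≤σ σ≤ρ) ρ<π) (∧-intro τ≤σ σ≤ρ))
          (λ t → let (τρπ , τσρ) = ∧-elim (Below π τ ρ) t
                     (_ , ρ<π) = ∧-elim (τ ≤ᵇ ρ) τρπ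
                     (ρ≤π , ρ≉π) = ∧-elim (ρ ≤ᵇ π) ρ<π
                     (τ≤σ , σ≤ρ) = ∧-elim (τ ≤ᵇ σ) τσρ
                     σ≤π = ≤ᵇ-trans σ ρ π lσ lρ lπ σ≤ρ ρ≤π
                     σ≉π = T-not⁺ _ (λ σ≈π → T-not⁻ _ ρ≉π (≈ᵇ-intro ρ π ρ≤π
                             (≤ᵇ-trans π σ ρ lπ lσ lρ (proj₂ (≈ᵇ-elim σ π σ≈π)) σ≤ρ))) in
                 ∧-intro (∧-intro τ≤σ (∧-intro σ≤π σ≉π)) (∧-intro σ≤ρ ρ<π))

      expand-S : ∀ σ → Len σ → ind (Below π τ σ) (- S σ) ≈ - Σ Πₙ (X σ)
      expand-S σ lσ = begin
        ind (Below π τ σ) (- S σ)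
          ≈⟨ ind-neg (Below π τ σ) _ ⟩
        - ind (Below π τ σ) (S σ)
          ≈⟨ -‿cong (ind-cong (Below π τ σ) (λ _ → Σ-filter (Below π σ) Πₙ (μ f Πₙ σ))) ⟩
        - ind (Below π τ σ) (Σ Πₙ (λ ρ → ind (Below π σ ρ) (μ f Πₙ σ ρ)))
          ≈⟨ -‿cong (ind-Σ (Below π τ σ) Πₙ _) ⟩
        - Σ Πₙ (λ ρ → ind (Below π τ σ) (ind (Below π σ ρ) (μ f Πₙ σ ρ)))
          ≈⟨ -‿cong (Σ-cong-local Πₙ (All.map (λ {ρ} lρ → reflexive (reindex σ ρ lσ lρ)) Πₙ-length)) ⟩
        - Σ Πₙ (X σ) ∎

      below-≈ᵇ : ∀ ρ → Len ρ → (Below π τ ρ ∧ τ ≈ᵇ ρ) ≡.≡ ρ ≈ᵇ τ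
      below-≈ᵇ ρ lρ = T-ext _ _
        (λ t → let (τ≤ρ , ρ≤τ) = ≈ᵇ-elim τ ρ (proj₂ (∧-elim (Below π τ ρ) t)) in
               ≈ᵇ-intro ρ τ ρ≤τ τ≤ρ)
        (λ t → let (ρ≤τ , τ≤ρ) = ≈ᵇ-elim ρ τ t
                   ρ≤π = ≤ᵇ-trans ρ τ π lρ lτ lπ ρ≤τ τ≤π
                   ρ≉π = T-not⁺ _ (λ ρ≈π →
                           π≰τ (≤ᵇ-trans π ρ τ lπ lρ lτ (proj₂ (≈ᵇ-elim ρ π ρ≈π)) ρ≤τ)) in
               ∧-intro (∧-intro τ≤ρ (∧-intro ρ≤π ρ≉π)) (≈ᵇ-intro τ ρ τ≤ρ ρ≤τ))

      fuel-bound : ∀ ρ → Len ρ → T (Below π τ ρ) → blockCount n (at τ) ≤ f +ℕ blockCount n (at ρ)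
      fuel-bound ρ lρ t =
        let (ρ≤π , ρ≉π) = ∧-elim (ρ ≤ᵇ π) (proj₂ (∧-elim (τ ≤ᵇ ρ) t))
            π≰ρ = λ π≤ρ → T-not⁻ _ ρ≉π (≈ᵇ-intro ρ π ρ≤π π≤ρ) in
        ≤-trans bound (≡.subst (_≤ f +ℕ blockCount n (at ρ)) (+-suc f _)
          (+-monoʳ-≤ f (<ᵇ-blockCount ρ π lρ lπ ρ≤π π≰ρ)))

    Σ-interval-μ-strict : (∀ ρ → Len ρ → blockCount n (at τ) ≤ f +ℕ blockCount n (at ρ) →
                            IntervalSum f τ ρ ≈ ind (τ ≈ᵇ ρ) 1#) →
                          IntervalSum (suc f) τ π ≈ 0#
    Σ-interval-μ-strict IH = begin
      IntervalSum (suc f) τ π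
        ≈⟨ Σ-cong-local Πₙ (All.map (λ {σ} → unfold-μ σ) Πₙ-length) ⟩
      Σ Πₙ (λ σ → ind (σ ≈ᵇ π) 1# + ind (Below π τ σ) (- S σ))
        ≈⟨ Σ-+ Πₙ _ _ ⟩
      Σ Πₙ (λ σ → ind (σ ≈ᵇ π) 1#) + Σ Πₙ (λ σ → ind (Below π τ σ) (- S σ))
        ≈⟨ +-cong (Σ-≈ᵇ π lπ) Σ-strictly-below ⟩
      1# + - 1#
        ≈⟨ -‿inverseʳ 1# ⟩
      0# ∎
      where
      Σ-strictly-below : Σ Πₙ (λ σ → ind (Below π τ σ) (- S σ)) ≈ - 1#
      Σ-strictly-below = begin
        Σ Πₙ (λ σ → ind (Below π τ σ) (- S σ))
          ≈⟨ Σ-cong-local Πₙ (All.map (λ {σ} → expand-S σ) Πₙ-length) ⟩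
        Σ Πₙ (λ σ → - Σ Πₙ (X σ))
          ≈⟨ Σ-neg Πₙ _ ⟩
        - Σ Πₙ (λ σ → Σ Πₙ (X σ))
          ≈⟨ -‿cong (Σ-swap Πₙ Πₙ X) ⟩
        - Σ Πₙ (λ ρ → Σ Πₙ (λ σ → X σ ρ))
          ≈⟨ -‿cong (Σ-cong Πₙ (λ ρ → sym (ind-Σ (Below π τ ρ) Πₙ _))) ⟩
        - Σ Πₙ (λ ρ → ind (Below π τ ρ) (IntervalSum f τ ρ))
          ≈⟨ -‿cong (Σ-cong-local Πₙ (All.map (λ {ρ} lρ → ind-cong (Below π τ ρ) (IH ρ lρ ∘ fuel-bound ρ lρ))
               Πₙ-length)) ⟩
        - Σ Πₙ (λ ρ → ind (Below π τ ρ) (ind (τ ≈ᵇ ρ) 1#))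
          ≈⟨ -‿cong (Σ-cong-local Πₙ (All.map (λ {ρ} lρ → reflexive
               (≡.trans (ind-∧ (Below π τ ρ) _ _) (≡.cong (λ b → ind b 1#) (below-≈ᵇ ρ lρ)))) Πₙ-length)) ⟩
        - Σ Πₙ (λ ρ → ind (ρ ≈ᵇ τ) 1#)
          ≈⟨ -‿cong (Σ-≈ᵇ τ lτ) ⟩
        - 1# ∎

  μ-≈ᵇ : ∀ fuel σ π → T (σ ≈ᵇ π) → μ fuel Πₙ σ π ≡.≡ 1#
  μ-≈ᵇ zero    σ π t with σ ≈ᵇ π
  ... | true = ≡.refl
  μ-≈ᵇ (suc f) σ π t with σ ≈ᵇ π
  ... | true = ≡.refl

  -- The sum over the first argument of μ, dual to the defining recursion (a sum over the second);
  -- the fuel bound guarantees that the recursion of μ is never cut off.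
  Σ-interval-μ : ∀ fuel τ π → Len τ → Len π → blockCount n (at τ) ≤ fuel +ℕ blockCount n (at π) →
    IntervalSum fuel τ π ≈ ind (τ ≈ᵇ π) 1#
  Σ-interval-μ fuel τ π lτ lπ bound with τ ≤ᵇ π in τ≤π | π ≤ᵇ τ in π≤τ
  ... | false | _ = Σ-zero Πₙ _ (All.map (λ {σ} lσ → reflexive (ind-false _ _ (λ t →
                      let (τ≤σ , σ≤π) = ∧-elim (τ ≤ᵇ σ) t in
                      ≡.subst T τ≤π (≤ᵇ-trans τ σ π lτ lσ lπ τ≤σ σ≤π)))) Πₙ-length)
  ... | true | true = trans (Σ-cong-local Πₙ (All.map (λ {σ} → term σ) Πₙ-length)) (Σ-≈ᵇ π lπ)
    where
    term : ∀ σ → Len σ → ind (τ ≤ᵇ σ ∧ σ ≤ᵇ π) (μ fuel Πₙ σ π) ≈ ind (σ ≈ᵇ π) 1#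
    term σ lσ = ≡.subst (λ b → ind b (μ fuel Πₙ σ π) ≈ ind (σ ≈ᵇ π) 1#) (≡.sym same)
                  (ind-cong (σ ≈ᵇ π) (reflexive ∘ μ-≈ᵇ fuel σ π))
      where
      same : (τ ≤ᵇ σ ∧ σ ≤ᵇ π) ≡.≡ σ ≈ᵇ π
      same = T-ext _ _
        (λ t → let (τ≤σ , σ≤π) = ∧-elim (τ ≤ᵇ σ) t in
               ≈ᵇ-intro σ π σ≤π (≤ᵇ-trans π τ σ lπ lτ lσ (≡.subst T (≡.sym π≤τ) _) τ≤σ))
        (λ t → let (σ≤π , π≤σ) = ≈ᵇ-elim σ π t in
               ∧-intro (≤ᵇ-trans τ π σ lτ lπ lσ (≡.subst T (≡.sym τ≤π) _) π≤σ) σ≤π)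
  ... | true | false with fuel
  ...   | zero  = ⊥-elim (≡.subst T π≤τ (≤ᵇ-antisym-blockCount τ π lτ lπ (≡.subst T (≡.sym τ≤π) _) bound))
  ...   | suc f = Σ-interval-μ-strict f τ π lτ lπ (≡.subst T (≡.sym τ≤π) _) (≡.subst T π≤τ) bound
                    (λ ρ lρ → Σ-interval-μ f τ ρ lτ lρ)

module Attachments where

  open import Data.Nat using (ℕ; zero; suc; _+_; _<_; z≤n; s≤s; _≡ᵇ_)
  open import Data.Nat.Properties
  open import Data.Bool using (Bool; true; false; T; _∧_)
  open import Data.Bool.Properties using (∧-identityʳ; ∧-assoc; T-∧)
  open import Data.List using (List; []; _∷_; _++_; map; concatMap; length; applyUpTo)
  import Data.List.Properties as List
  open import Data.List.Relation.Unary.All as All using (All; []; _∷_)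
  import Data.List.Relation.Unary.All.Properties as All
  open import Data.List.Membership.Propositional using (_∈_)
  open import Data.List.Relation.Unary.Any using (here; there)
  open import Data.Product using (_×_; _,_; proj₁; proj₂; ∃)
  open import Data.Unit using (⊤)
  open import Data.Empty using (⊥-elim)
  open import Function using (_∘_)
  open import Function.Bundles using (Equivalence)
  open import Relation.Binary.PropositionalEquality
  open Booleans using (T-ext; ≡ᵇ-refl)
  open Counting using (length-∷ʳ; countᵇ; countᵇ-≡ᵇ-absent)
  open SetPartitions using (at; refinesB⇒Finer; Finer⇒refinesB)

  coloredWord : List ℕ → List Eps → List Letter
  coloredWord []       _        = []
  coloredWord (c ∷ cs) []       = []
  coloredWord (c ∷ cs) (e ∷ es) = letters c e ++ coloredWord cs es

  coloredWord-∷ʳ : ∀ cs es c e → length cs ≡ length es →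
    coloredWord (cs ++ c ∷ []) (es ++ e ∷ []) ≡ coloredWord cs es ++ letters c e
  coloredWord-∷ʳ []        []        c e _ = List.++-identityʳ _
  coloredWord-∷ʳ (c′ ∷ cs) (e′ ∷ es) c e l =
    trans (cong (letters c′ e′ ++_) (coloredWord-∷ʳ cs es c e (suc-injective l)))
          (sym (List.++-assoc (letters c′ e′) _ _))

  coloredWord-applyUpTo-∷ʳ : ∀ (χ : ℕ → ℕ) es e →
    coloredWord (applyUpTo χ (length (es ++ e ∷ []))) (es ++ e ∷ [])
      ≡ coloredWord (applyUpTo χ (length es)) es ++ letters (χ (length es)) e
  coloredWord-applyUpTo-∷ʳ χ es e rewrite length-∷ʳ es e | sym (List.applyUpTo-∷ʳ χ (length es)) =
    coloredWord-∷ʳ (applyUpTo χ (length es)) es (χ (length es)) e (List.length-applyUpTo χ (length es))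

  -- An attachment sends every star to one of the positions Pl (meant to be the powers)
  -- and every power to its own position; positions are counted from k.
  targets : List ℕ → Eps → ℕ → List ℕ
  targets Pl star    k = Pl
  targets Pl (pow _) k = k ∷ []

  attachments : List ℕ → List Eps → ℕ → List (List ℕ)
  attachments Pl []       k = [] ∷ []
  attachments Pl (e ∷ es) k = concatMap (λ p → map (p ∷_) (attachments Pl es (suc k))) (targets Pl e k)

  sameColour : (ℕ → ℕ) → Eps → ℕ → ℕ → Bool
  sameColour χ star    j p = χ j ≡ᵇ χ p
  sameColour χ (pow _) j p = true

  respects : (ℕ → ℕ) → List Eps → List ℕ → ℕ → Bool
  respects χ []       _        k = true
  respects χ (e ∷ es) []       k = false
  respects χ (e ∷ es) (p ∷ cs) k = sameColour χ e k p ∧ respects χ es cs (suc k)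

  respects-∷ʳ : ∀ χ es cs e p k → length cs ≡ length es →
    respects χ (es ++ e ∷ []) (cs ++ p ∷ []) k ≡ (respects χ es cs k ∧ sameColour χ e (k + length es) p)
  respects-∷ʳ χ []        []        e p k _ rewrite +-identityʳ k = ∧-identityʳ _
  respects-∷ʳ χ (e′ ∷ es) (c′ ∷ cs) e p k l
    rewrite respects-∷ʳ χ es cs e p (suc k) (suc-injective l) | +-suc k (length es) =
    sym (∧-assoc (sameColour χ e′ k c′) _ _)

  PowersIn : List ℕ → List Eps → ℕ → Set
  PowersIn Pl []           k = ⊤
  PowersIn Pl (star ∷ es)  k = PowersIn Pl es (suc k)
  PowersIn Pl (pow m ∷ es) k = k ∈ Pl × PowersIn Pl es (suc k)

  PowerIn : List ℕ → Eps → ℕ → Set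
  PowerIn Pl star    j = ⊤
  PowerIn Pl (pow m) j = j ∈ Pl

  PowersIn-∷ʳ : ∀ Pl es e k → PowersIn Pl (es ++ e ∷ []) k → PowersIn Pl es k × PowerIn Pl e (k + length es)
  PowersIn-∷ʳ Pl []           star    k _ = _ , _
  PowersIn-∷ʳ Pl []           (pow m) k (k∈Pl , _) rewrite +-identityʳ k = _ , k∈Pl
  PowersIn-∷ʳ Pl (star ∷ es)  e k h rewrite +-suc k (length es) = PowersIn-∷ʳ Pl es e (suc k) h
  PowersIn-∷ʳ Pl (pow m ∷ es) e k (k∈Pl , h) rewrite +-suc k (length es) =
    let (init , last) = PowersIn-∷ʳ Pl es e (suc k) h in (k∈Pl , init) , last

  entry : List Eps → ℕ → Eps
  entry []       _       = star
  entry (e ∷ es) zero    = e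
  entry (e ∷ es) (suc i) = entry es i

  powerPositions : List Eps → ℕ → List ℕ
  powerPositions []           k = []
  powerPositions (star ∷ es)  k = powerPositions es (suc k)
  powerPositions (pow _ ∷ es) k = k ∷ powerPositions es (suc k)

  powerPositions-≥ : ∀ es k → All (k ≤_) (powerPositions es k)
  powerPositions-≥ []           k = []
  powerPositions-≥ (star ∷ es)  k = All.map (≤-trans (n≤1+n k)) (powerPositions-≥ es (suc k))
  powerPositions-≥ (pow _ ∷ es) k = ≤-refl ∷ All.map (≤-trans (n≤1+n k)) (powerPositions-≥ es (suc k))

  powerPositions-once : ∀ es k d → d ∈ powerPositions es k → countᵇ (_≡ᵇ d) (powerPositions es k) ≡ 1
  powerPositions-once (star ∷ es)  k d d∈ = powerPositions-once es (suc k) d d∈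
  powerPositions-once (pow _ ∷ es) k .k (here refl) rewrite ≡ᵇ-refl k =
    cong suc (countᵇ-≡ᵇ-absent k (powerPositions es (suc k)) (powerPositions-≥ es (suc k)))
  powerPositions-once (pow _ ∷ es) k d (there d∈) with k ≡ᵇ d in eq
  ... | true  = ⊥-elim (<-irrefl (≡ᵇ⇒≡ k d (subst T (sym eq) _)) (All.lookup (powerPositions-≥ es (suc k)) d∈))
  ... | false = powerPositions-once es (suc k) d d∈

  ∈-powerPositions⁻ : ∀ es k x → x ∈ powerPositions es k →
    ∃ λ i → x ≡ k + i × i < length es × ∃ λ b → entry es i ≡ pow b
  ∈-powerPositions⁻ (star ∷ es) k x x∈ =
    let (i , x≡ , i< , b , eb) = ∈-powerPositions⁻ es (suc k) x x∈ in
    suc i , trans x≡ (sym (+-suc k i)) , s≤s i< , b , eb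
  ∈-powerPositions⁻ (pow b ∷ es) k .k (here refl) = 0 , sym (+-identityʳ k) , s≤s z≤n , b , refl
  ∈-powerPositions⁻ (pow _ ∷ es) k x (there x∈) =
    let (i , x≡ , i< , b , eb) = ∈-powerPositions⁻ es (suc k) x x∈ in
    suc i , trans x≡ (sym (+-suc k i)) , s≤s i< , b , eb

  PowersIn-⊇ : ∀ es k Pl → (∀ x → x ∈ powerPositions es k → x ∈ Pl) → PowersIn Pl es k
  PowersIn-⊇ []           k Pl _ = _
  PowersIn-⊇ (star ∷ es)  k Pl ⊇ = PowersIn-⊇ es (suc k) Pl ⊇
  PowersIn-⊇ (pow _ ∷ es) k Pl ⊇ = ⊇ k (here refl) , PowersIn-⊇ es (suc k) Pl (λ x → ⊇ x ∘ there)

  IsAttachment : List ℕ → List Eps → ℕ → List ℕ → Set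
  IsAttachment Pl es k cs = length cs ≡ length es × (∀ i → i < length es →
    (entry es i ≡ star → at cs i ∈ Pl) × (∀ b → entry es i ≡ pow b → at cs i ≡ k + i))

  attachments-valid : ∀ Pl es k → All (IsAttachment Pl es k) (attachments Pl es k)
  attachments-valid Pl []       k = (refl , (λ _ ())) ∷ []
  attachments-valid Pl (e ∷ es) k = All.concat⁺ (All.map⁺ (All.tabulate {xs = targets Pl e k} (λ {p} p∈ →
    All.map⁺ {f = p ∷_} (All.map (cons p p∈ _) (attachments-valid Pl es (suc k))))))
    where
    head : ∀ e′ p → p ∈ targets Pl e′ k → (e′ ≡ star → p ∈ Pl) × (∀ b → e′ ≡ pow b → p ≡ k + 0)
    head star     p p∈         = (λ _ → p∈) , (λ _ ())
    head (pow _) .k (here refl) = (λ ()) , (λ _ _ → sym (+-identityʳ k))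
    cons : ∀ p → p ∈ targets Pl e k → ∀ cs → IsAttachment Pl es (suc k) cs → IsAttachment Pl (e ∷ es) k (p ∷ cs)
    cons p p∈ cs (lcs , valid) = cong suc lcs , λ where
      zero    _         → head e p p∈
      (suc i) (s≤s i<) → proj₁ (valid i i<) , (λ b eb → trans (proj₂ (valid i i<) b eb) (sym (+-suc k i)))

  attachments-length : ∀ Pl es k → All (λ cs → length cs ≡ length es) (attachments Pl es k)
  attachments-length Pl es k = All.map proj₁ (attachments-valid Pl es k)

  respects⁻ : ∀ χ es cs k → length cs ≡ length es → T (respects χ es cs k) →
    ∀ i → i < length es → entry es i ≡ star → χ (k + i) ≡ χ (at cs i)
  respects⁻ χ (star ∷ es) (p ∷ cs) k _ t zero _ _ =
    trans (cong χ (+-identityʳ k)) (≡ᵇ⇒≡ _ _ (proj₁ (Equivalence.to T-∧ t)))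
  respects⁻ χ (e ∷ es) (p ∷ cs) k lcs t (suc i) (s≤s i<) ei =
    trans (cong χ (+-suc k i)) (respects⁻ χ es cs (suc k) (suc-injective lcs) (proj₂ (Equivalence.to T-∧ t)) i i< ei)

  respects⁺ : ∀ χ es cs k → length cs ≡ length es →
    (∀ i → i < length es → entry es i ≡ star → χ (k + i) ≡ χ (at cs i)) → T (respects χ es cs k)
  respects⁺ χ []       cs       k _   _ = _
  respects⁺ χ (e ∷ es) (p ∷ cs) k lcs h = Equivalence.from T-∧ (head e refl ,
    respects⁺ χ es cs (suc k) (suc-injective lcs)
      (λ i i< ei → trans (cong χ (sym (+-suc k i))) (h (suc i) (s≤s i<) ei)))
    where
    head : ∀ e′ → e′ ≡ e → T (sameColour χ e′ k p)
    head star    refl = ≡⇒≡ᵇ _ _ (trans (cong χ (sym (+-identityʳ k))) (h 0 (s≤s z≤n) refl))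
    head (pow _) _    = _

  module _ (es : List Eps) (cs : List ℕ) (valid : IsAttachment (powerPositions es 0) es 0 cs) where

    private
      n = length es

    attached-idempotent : ∀ i → i < n → entry es i ≡ star → at cs i < n × at cs (at cs i) ≡ at cs i
    attached-idempotent i i<n ei =
      let (i′ , e , i′<n , b , eb) = ∈-powerPositions⁻ es 0 (at cs i) (proj₁ (proj₂ valid i i<n) ei) in
      subst (_< n) (sym e) i′<n , trans (cong (at cs) e) (trans (proj₂ (proj₂ valid i′ i′<n) b eb) (sym e))

    respects-refinesB : ∀ σ → length σ ≡ n → respects (λ i → suc (at σ i)) es cs 0 ≡ refinesB cs σ
    respects-refinesB σ lσ = T-ext _ _ respects⇒refines refines⇒respects
      where
      χ = λ i → suc (at σ i)
      σ-constant : T (respects χ es cs 0) → ∀ i → i < n → at σ i ≡ at σ (at cs i)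
      σ-constant t i i<n with entry es i in ei
      ... | star  = suc-injective (respects⁻ χ es cs 0 (proj₁ valid) t i i<n ei)
      ... | pow b = cong (at σ) (sym (proj₂ (proj₂ valid i i<n) b ei))
      respects⇒refines : T (respects χ es cs 0) → T (refinesB cs σ)
      respects⇒refines t = Finer⇒refinesB cs σ (proj₁ valid) lσ (λ i j i<n j<n e →
        trans (σ-constant t i i<n) (trans (cong (at σ) e) (sym (σ-constant t j j<n))))
      refines⇒respects : T (refinesB cs σ) → T (respects χ es cs 0)
      refines⇒respects t = respects⁺ χ es cs 0 (proj₁ valid) (λ i i<n ei →
        let (ci<n , fixed) = attached-idempotent i i<n ei in
        cong suc (refinesB⇒Finer cs σ (proj₁ valid) lσ t i (at cs i) i<n ci<n (sym fixed)))

module FockLinearity {c ℓ} (R : CommutativeRing c ℓ) (q : CommutativeRing.Carrier R) where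

  open import Level using (_⊔_)
  open import Data.Nat using (ℕ; zero; suc)
  open import Data.List using (List; []; _∷_; _++_; map; replicate)
  import Data.List.Properties as List
  open import Data.Product using (_×_; _,_; proj₁; proj₂)
  import Relation.Binary.PropositionalEquality as ≡

  open CommutativeRing R
  open Fock R q
  open RingSums R
  open import Relation.Binary.Reasoning.Setoid setoid

  infix 4 _≋_
  data _≋_ : Vect → Vect → Set (c ⊔ ℓ) where
    []  : [] ≋ []
    _∷_ : ∀ {a b w v v′} → a ≈ b → v ≋ v′ → ((a , w) ∷ v) ≋ ((b , w) ∷ v′)

  ≋-refl : ∀ v → v ≋ v
  ≋-refl []           = []
  ≋-refl ((a , w) ∷ v) = refl ∷ ≋-refl v

  ≋-trans : ∀ {u v w} → u ≋ v → v ≋ w → u ≋ w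
  ≋-trans []        []        = []
  ≋-trans (a≈b ∷ e) (b≈c ∷ f) = trans a≈b b≈c ∷ ≋-trans e f

  ≋-++ : ∀ {v₁ v₁′ v₂ v₂′} → v₁ ≋ v₁′ → v₂ ≋ v₂′ → (v₁ ++ v₂) ≋ (v₁′ ++ v₂′)
  ≋-++ []        e = e
  ≋-++ (a≈b ∷ e₁) e₂ = a≈b ∷ ≋-++ e₁ e₂

  scale : Carrier → Vect → Vect
  scale a = map (λ p → a * proj₁ p , proj₂ p)

  expect : List Letter → Vect → Carrier
  expect ws v = vac (applyWord ws v)

  applyWord-++ : ∀ ws ws′ v → applyWord (ws ++ ws′) v ≡.≡ applyWord ws (applyWord ws′ v)
  applyWord-++ []       ws′ v = ≡.refl
  applyWord-++ (l ∷ ws) ws′ v = ≡.cong (applyLetter l) (applyWord-++ ws ws′ v)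

  applyLetter-++ᵛ : ∀ l v v′ → applyLetter l (v ++ v′) ≡.≡ applyLetter l v ++ applyLetter l v′
  applyLetter-++ᵛ (cre c) v v′ = List.map-++ _ v v′
  applyLetter-++ᵛ (ann c) v v′ = List.concatMap-++ _ v v′

  applyWord-++ᵛ : ∀ ws v v′ → applyWord ws (v ++ v′) ≡.≡ applyWord ws v ++ applyWord ws v′
  applyWord-++ᵛ []       v v′ = ≡.refl
  applyWord-++ᵛ (l ∷ ws) v v′ = ≡.trans (≡.cong (applyLetter l) (applyWord-++ᵛ ws v v′)) (applyLetter-++ᵛ l _ _)

  applyWord-[] : ∀ ws → applyWord ws [] ≡.≡ []
  applyWord-[] []           = ≡.refl
  applyWord-[] (cre c ∷ ws) rewrite applyWord-[] ws = ≡.refl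
  applyWord-[] (ann c ∷ ws) rewrite applyWord-[] ws = ≡.refl

  applyWord-replicate-cre : ∀ m c a u →
    applyWord (replicate m (cre c)) ((a , u) ∷ []) ≡.≡ (a , replicate m c ++ u) ∷ []
  applyWord-replicate-cre zero    c a u = ≡.refl
  applyWord-replicate-cre (suc m) c a u rewrite applyWord-replicate-cre m c a u = ≡.refl

  vac-++ : ∀ v v′ → vac (v ++ v′) ≈ vac v + vac v′
  vac-++ []                 v′ = sym (+-identityˡ _)
  vac-++ ((a , []) ∷ v)     v′ = trans (+-congˡ (vac-++ v v′)) (sym (+-assoc a _ _))
  vac-++ ((a , _ ∷ _) ∷ v) v′ = vac-++ v v′

  vac-≋ : ∀ {v v′} → v ≋ v′ → vac v ≈ vac v′
  vac-≋ []                            = refl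
  vac-≋ {(_ , []) ∷ _}     (a≈b ∷ e) = +-cong a≈b (vac-≋ e)
  vac-≋ {(_ , _ ∷ _) ∷ _} (_ ∷ e)   = vac-≋ e

  vac-scale : ∀ a v → vac (scale a v) ≈ a * vac v
  vac-scale a []                 = sym (zeroʳ a)
  vac-scale a ((b , []) ∷ v)     = trans (+-congˡ (vac-scale a v)) (sym (distribˡ a b _))
  vac-scale a ((b , _ ∷ _) ∷ v) = vac-scale a v

  scale-≋ : ∀ {a b} → a ≈ b → ∀ u → scale a u ≋ scale b u
  scale-≋ a≈b []      = []
  scale-≋ a≈b (r ∷ u) = *-congʳ a≈b ∷ scale-≋ a≈b u

  applyLetter-≋ : ∀ l {v v′} → v ≋ v′ → applyLetter l v ≋ applyLetter l v′
  applyLetter-≋ (cre c) []        = []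
  applyLetter-≋ (cre c) (a≈b ∷ e) = a≈b ∷ applyLetter-≋ (cre c) e
  applyLetter-≋ (ann c) []        = []
  applyLetter-≋ (ann c) {(a , w) ∷ v} (a≈b ∷ e) = ≋-++ (scale-≋ a≈b (annW c w)) (applyLetter-≋ (ann c) e)

  applyLetter-scale : ∀ l a v → applyLetter l (scale a v) ≋ scale a (applyLetter l v)
  applyLetter-scale (cre c) a []      = []
  applyLetter-scale (cre c) a (p ∷ v) = refl ∷ applyLetter-scale (cre c) a v
  applyLetter-scale (ann c) a []      = []
  applyLetter-scale (ann c) a ((b , w) ∷ v) =
    ≡.subst (applyLetter (ann c) (scale a ((b , w) ∷ v)) ≋_)
      (≡.sym (List.map-++ _ (scale b (annW c w)) (applyLetter (ann c) v)))
      (≋-++ (assoc (annW c w)) (applyLetter-scale (ann c) a v))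
    where
    assoc : ∀ u → scale (a * b) u ≋ scale a (scale b u)
    assoc []      = []
    assoc (r ∷ u) = *-assoc a b _ ∷ assoc u

  applyWord-≋ : ∀ ws {v v′} → v ≋ v′ → applyWord ws v ≋ applyWord ws v′
  applyWord-≋ []       e = e
  applyWord-≋ (l ∷ ws) e = applyLetter-≋ l (applyWord-≋ ws e)

  applyWord-scale : ∀ ws a v → applyWord ws (scale a v) ≋ scale a (applyWord ws v)
  applyWord-scale []       a v = ≋-refl _
  applyWord-scale (l ∷ ws) a v = ≋-trans (applyLetter-≋ l (applyWord-scale ws a v)) (applyLetter-scale l a _)

  basis : List ℕ → Vect
  basis w = (1# , w) ∷ []

  expect-linear : ∀ ws v → expect ws v ≈ Σ v (λ p → proj₁ p * expect ws (basis (proj₂ p)))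
  expect-linear ws []            = reflexive (≡.cong vac (applyWord-[] ws))
  expect-linear ws ((a , w) ∷ v) = begin
    vac (applyWord ws (((a , w) ∷ []) ++ v))
      ≡⟨ ≡.cong vac (applyWord-++ᵛ ws ((a , w) ∷ []) v) ⟩
    vac (applyWord ws ((a , w) ∷ []) ++ applyWord ws v)
      ≈⟨ vac-++ (applyWord ws ((a , w) ∷ [])) (applyWord ws v) ⟩
    expect ws ((a , w) ∷ []) + expect ws v
      ≈⟨ +-cong single (expect-linear ws v) ⟩
    a * expect ws (basis w) + Σ v (λ p → proj₁ p * expect ws (basis (proj₂ p))) ∎
    where
    single : expect ws ((a , w) ∷ []) ≈ a * expect ws (basis w)
    single = begin
      vac (applyWord ws ((a , w) ∷ []))        ≈⟨ vac-≋ (applyWord-≋ ws (sym (*-identityʳ a) ∷ [])) ⟩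
      vac (applyWord ws (scale a (basis w)))   ≈⟨ vac-≋ (applyWord-scale ws a _) ⟩
      vac (scale a (applyWord ws (basis w)))   ≈⟨ vac-scale a (applyWord ws (basis w)) ⟩
      a * expect ws (basis w)                  ∎

  expect-ann : ∀ W c u →
    expect (W ++ ann c ∷ []) (basis u) ≈ Σ (annW c u) (λ r → proj₁ r * expect W (basis (proj₂ r)))
  expect-ann W c u = begin
    vac (applyWord (W ++ ann c ∷ []) (basis u))       ≡⟨ ≡.cong vac (applyWord-++ W (ann c ∷ []) _) ⟩
    expect W (scale 1# (annW c u) ++ [])              ≈⟨ expect-linear W _ ⟩
    Σ (scale 1# (annW c u) ++ []) G
      ≡⟨ ≡.cong (λ z → Σ z G) (List.++-identityʳ (scale 1# (annW c u))) ⟩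
    Σ (scale 1# (annW c u)) G                         ≡⟨ Σ-map _ (annW c u) G ⟩
    Σ (annW c u) (λ r → (1# * proj₁ r) * expect W (basis (proj₂ r)))
      ≈⟨ Σ-cong (annW c u) (λ r → *-congʳ (*-identityˡ _)) ⟩
    Σ (annW c u) (λ r → proj₁ r * expect W (basis (proj₂ r))) ∎
    where
    G : Carrier × List ℕ → Carrier
    G p = proj₁ p * expect W (basis (proj₂ p))

module WickExpansion {c ℓ} (R : CommutativeRing c ℓ) (q : CommutativeRing.Carrier R) where

  open import Data.Nat using (ℕ; suc; _≡ᵇ_) renaming (_+_ to _+ℕ_)
  open import Data.Nat.Properties using (+-suc) renaming (+-identityʳ to +ℕ-identityʳ)
  open import Data.Bool using (Bool; true; false; _∧_; if_then_else_)
  open import Data.Bool.Properties using (∧-identityʳ)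
  open import Data.List using (List; []; _∷_; _++_; map; concatMap; length; replicate; applyUpTo)
  import Data.List.Properties as List
  open import Data.List.Relation.Unary.All as All using (All; []; _∷_)
  import Data.List.Relation.Unary.All.Properties as All
  open import Data.List.Membership.Propositional using (_∈_)
  open import Data.List.Reverse using (Reverse; []; _∶_∶ʳ_)
  open import Data.Product using (_×_; _,_; proj₁; proj₂)
  open import Function using (id)
  import Relation.Binary.PropositionalEquality as ≡
  open Counting using (countᵇ)
  open Attachments

  open CommutativeRing R
  open Fock R q
  open RingSums R
  open FockLinearity R q
  open import Relation.Binary.Reasoning.Setoid setoid

  Σ-attachments-∷ʳ : ∀ Pl es e k (F : List ℕ → Carrier) →
    Σ (attachments Pl (es ++ e ∷ []) k) F
      ≈ Σ (attachments Pl es k) (λ cs → Σ (targets Pl e (k +ℕ length es)) (λ p → F (cs ++ p ∷ [])))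
  Σ-attachments-∷ʳ Pl [] e k F rewrite +ℕ-identityʳ k = begin
    Σ (concatMap (λ p → map (p ∷_) ([] ∷ [])) (targets Pl e k)) F ≈⟨ Σ-concatMap _ (targets Pl e k) F ⟩
    Σ (targets Pl e k) (λ p → F (p ∷ []) + 0#)                    ≈⟨ Σ-cong (targets Pl e k) (λ p → +-identityʳ _) ⟩
    Σ (targets Pl e k) (λ p → F (p ∷ []))                          ≈⟨ sym (+-identityʳ _) ⟩
    Σ (targets Pl e k) (λ p → F (p ∷ [])) + 0#                     ∎
  Σ-attachments-∷ʳ Pl (e′ ∷ es) e k F rewrite +-suc k (length es) = begin
    Σ (concatMap (λ p → map (p ∷_) (attachments Pl (es ++ e ∷ []) (suc k))) (targets Pl e′ k)) F
      ≈⟨ Σ-concatMap _ (targets Pl e′ k) F ⟩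
    Σ (targets Pl e′ k) (λ p → Σ (map (p ∷_) (attachments Pl (es ++ e ∷ []) (suc k))) F)
      ≈⟨ Σ-cong (targets Pl e′ k) (λ p → begin
           Σ (map (p ∷_) (attachments Pl (es ++ e ∷ []) (suc k))) F
             ≡⟨ Σ-map (p ∷_) (attachments Pl (es ++ e ∷ []) (suc k)) F ⟩
           Σ (attachments Pl (es ++ e ∷ []) (suc k)) (λ cs → F (p ∷ cs))
             ≈⟨ Σ-attachments-∷ʳ Pl es e (suc k) _ ⟩
           Σ (attachments Pl es (suc k)) (λ cs → G (p ∷ cs))
             ≡⟨ Σ-map (p ∷_) (attachments Pl es (suc k)) G ⟨
           Σ (map (p ∷_) (attachments Pl es (suc k))) G ∎) ⟩
    Σ (targets Pl e′ k) (λ p → Σ (map (p ∷_) (attachments Pl es (suc k))) G)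
      ≈⟨ Σ-concatMap _ (targets Pl e′ k) G ⟨
    Σ (concatMap (λ p → map (p ∷_) (attachments Pl es (suc k))) (targets Pl e′ k)) G ∎
    where
    G : List ℕ → Carrier
    G cs = Σ (targets Pl e (suc (k +ℕ length es))) (λ p → F (cs ++ p ∷ []))

  -- annW c (map χ w), but keeping the labels of w: the factors w_k with χ w_k ≡ c are removed
  annPreimage : (ℕ → ℕ) → ℕ → List ℕ → Vect
  annPreimage χ c []      = []
  annPreimage χ c (d ∷ w) =
    (if c ≡ᵇ χ d then (1# , w) ∷ [] else []) ++ map (λ p → (q * proj₁ p , d ∷ proj₂ p)) (annPreimage χ c w)

  relabel : (ℕ → ℕ) → Vect → Vect
  relabel χ = map (λ r → proj₁ r , map χ (proj₂ r))

  annW-map : ∀ χ c w → annW c (map χ w) ≡.≡ relabel χ (annPreimage χ c w)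
  annW-map χ c []      = ≡.refl
  annW-map χ c (d ∷ w) = ≡.trans
    (≡.cong₂ _++_ (relabel-here (c ≡ᵇ χ d))
       (≡.trans (≡.cong (map (λ p → q * proj₁ p , χ d ∷ proj₂ p)) (annW-map χ c w))
          (≡.trans (≡.sym (List.map-∘ (annPreimage χ c w))) (List.map-∘ (annPreimage χ c w)))))
    (≡.sym (List.map-++ _ (if c ≡ᵇ χ d then (1# , w) ∷ [] else []) _))
    where
    relabel-here : ∀ b →
      (if b then (1# , map χ w) ∷ [] else []) ≡.≡ relabel χ (if b then (1# , w) ∷ [] else [])
    relabel-here true  = ≡.refl
    relabel-here false = ≡.refl

  annW-annPreimage : ∀ c w → annW c w ≡.≡ annPreimage id c w
  annW-annPreimage c []      = ≡.refl
  annW-annPreimage c (d ∷ w) rewrite annW-annPreimage c w = ≡.refl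

  annPreimage-⊆ : ∀ {Pl : List ℕ} χ c w → All (_∈ Pl) w →
    All (λ r → All (_∈ Pl) (proj₂ r)) (annPreimage χ c w)
  annPreimage-⊆ χ c []      _            = []
  annPreimage-⊆ χ c (d ∷ w) (d∈Pl ∷ w⊆Pl) =
    All.++⁺ removed-here (All.map⁺ (All.map (d∈Pl ∷_) (annPreimage-⊆ χ c w w⊆Pl)))
    where
    removed-here : All (λ r → All (_∈ _) (proj₂ r)) (if c ≡ᵇ χ d then (1# , w) ∷ [] else [])
    removed-here with c ≡ᵇ χ d
    ... | true  = w⊆Pl ∷ []
    ... | false = []

  annSum : (ℕ → ℕ) → ℕ → List ℕ → (List ℕ → Carrier) → Carrier
  annSum χ c w H = Σ (annPreimage χ c w) (λ r → proj₁ r * H (proj₂ r))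

  annSum-∷ : ∀ χ c d w H →
    annSum χ c (d ∷ w) H ≈ ind (c ≡ᵇ χ d) (H w) + q * annSum χ c w (λ u → H (d ∷ u))
  annSum-∷ χ c d w H = begin
    annSum χ c (d ∷ w) H
      ≈⟨ Σ-++ (if c ≡ᵇ χ d then (1# , w) ∷ [] else []) _ _ ⟩
    Σ (if c ≡ᵇ χ d then (1# , w) ∷ [] else []) G
      + Σ (map (λ p → (q * proj₁ p , d ∷ proj₂ p)) (annPreimage χ c w)) G
      ≈⟨ +-cong removed-here (reflexive (Σ-map _ (annPreimage χ c w) G)) ⟩
    ind (c ≡ᵇ χ d) (H w) + Σ (annPreimage χ c w) (λ r → (q * proj₁ r) * H (d ∷ proj₂ r))
      ≈⟨ +-congˡ (trans (Σ-cong (annPreimage χ c w) (λ r → *-assoc q (proj₁ r) _))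
                        (Σ-distribˡ (annPreimage χ c w) q _)) ⟩
    ind (c ≡ᵇ χ d) (H w) + q * annSum χ c w (λ u → H (d ∷ u)) ∎
    where
    G : Carrier × List ℕ → Carrier
    G r = proj₁ r * H (proj₂ r)
    removed-here : Σ (if c ≡ᵇ χ d then (1# , w) ∷ [] else []) G ≈ ind (c ≡ᵇ χ d) (H w)
    removed-here with c ≡ᵇ χ d
    ... | true  = trans (+-identityʳ _) (*-identityˡ _)
    ... | false = refl

  annSum-Σ-ind : ∀ {a} {A : Set a} χ c w (xs : List A) (b : A → Bool) (H : A → List ℕ → Carrier) →
    annSum χ c w (λ u → Σ xs (λ x → ind (b x) (H x u))) ≈ Σ xs (λ x → ind (b x) (annSum χ c w (H x)))
  annSum-Σ-ind χ c w xs b H = begin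
    Σ P (λ r → proj₁ r * Σ xs (λ x → ind (b x) (H x (proj₂ r))))
      ≈⟨ Σ-cong P (λ r → sym (Σ-distribˡ xs (proj₁ r) _)) ⟩
    Σ P (λ r → Σ xs (λ x → proj₁ r * ind (b x) (H x (proj₂ r))))
      ≈⟨ Σ-swap P xs _ ⟩
    Σ xs (λ x → Σ P (λ r → proj₁ r * ind (b x) (H x (proj₂ r))))
      ≈⟨ Σ-cong xs (λ x → trans (Σ-cong P (λ r → sym (ind-*ˡ (b x) (proj₁ r) _))) (sym (ind-Σ (b x) P _))) ⟩
    Σ xs (λ x → ind (b x) (annSum χ c w (H x))) ∎
    where
    P = annPreimage χ c w

  module _ (Pl : List ℕ) (Pl-once : ∀ d → d ∈ Pl → countᵇ (_≡ᵇ d) Pl ≡.≡ 1) (χ : ℕ → ℕ) where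

    -- Annihilating colour c splits over the labels p ∈ Pl of that colour, each listed once in Pl.
    Σ-annSum-colour : ∀ c w → All (_∈ Pl) w → ∀ H →
      Σ Pl (λ p → ind (c ≡ᵇ χ p) (annSum id p w H)) ≈ annSum χ c w H
    Σ-annSum-colour c []      _             H = Σ-zero Pl _ (All.tabulate (λ {p} _ → ind-zero (c ≡ᵇ χ p)))
    Σ-annSum-colour c (d ∷ w) (d∈Pl ∷ w⊆Pl) H = begin
      Σ Pl (λ p → ind (c ≡ᵇ χ p) (annSum id p (d ∷ w) H))
        ≈⟨ Σ-cong Pl (λ p → trans (ind-cong (c ≡ᵇ χ p) (λ _ → annSum-∷ id p d w H))
                                  (ind-+ (c ≡ᵇ χ p) _ _)) ⟩
      Σ Pl (λ p → ind (c ≡ᵇ χ p) (ind (p ≡ᵇ d) (H w)) + ind (c ≡ᵇ χ p) (q * annSum id p w H′))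
        ≈⟨ Σ-+ Pl _ _ ⟩
      Σ Pl (λ p → ind (c ≡ᵇ χ p) (ind (p ≡ᵇ d) (H w)))
        + Σ Pl (λ p → ind (c ≡ᵇ χ p) (q * annSum id p w H′))
        ≈⟨ +-cong here there ⟩
      ind (c ≡ᵇ χ d) (H w) + q * annSum χ c w H′
        ≈⟨ sym (annSum-∷ χ c d w H) ⟩
      annSum χ c (d ∷ w) H ∎
      where
      H′ : List ℕ → Carrier
      H′ u = H (d ∷ u)
      here : Σ Pl (λ p → ind (c ≡ᵇ χ p) (ind (p ≡ᵇ d) (H w))) ≈ ind (c ≡ᵇ χ d) (H w)
      here = trans (Σ-cong Pl (λ p → reflexive (ind-comm (c ≡ᵇ χ p) (p ≡ᵇ d) _)))
                   (Σ-ind-≡ᵇ d Pl (Pl-once d d∈Pl) (λ p → ind (c ≡ᵇ χ p) (H w)))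
      there : Σ Pl (λ p → ind (c ≡ᵇ χ p) (q * annSum id p w H′)) ≈ q * annSum χ c w H′
      there = trans (Σ-cong Pl (λ p → ind-*ˡ (c ≡ᵇ χ p) q _))
                (trans (Σ-distribˡ Pl q _) (*-congˡ (Σ-annSum-colour c w w⊆Pl H′)))

    attachedValue : List Eps → List ℕ → List ℕ → Carrier
    attachedValue es cs u = expect (coloredWord cs es) (basis u)

    attachedSum : List Eps → List ℕ → Carrier
    attachedSum es u = Σ (attachments Pl es 0) (λ cs → ind (respects χ es cs 0) (attachedValue es cs u))

    private
      W : List Eps → List Letter
      W es = coloredWord (applyUpTo χ (length es)) es

      attachedSum-∷ʳ-star : ∀ es w →
        attachedSum (es ++ star ∷ []) w
          ≈ Σ Pl (λ p → ind (χ (length es) ≡ᵇ χ p) (annSum id p w (attachedSum es)))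
      attachedSum-∷ʳ-star es w = begin
        attachedSum (es ++ star ∷ []) w
          ≈⟨ Σ-attachments-∷ʳ Pl es star 0 _ ⟩
        Σ Cl (λ cs → Σ Pl (λ p → ind (respects χ (es ++ star ∷ []) (cs ++ p ∷ []) 0)
                                     (attachedValue (es ++ star ∷ []) (cs ++ p ∷ []) w)))
          ≈⟨ Σ-cong-local Cl (All.map (λ {cs} lcs → Σ-cong Pl (λ p → last-step cs p lcs))
               (attachments-length Pl es 0)) ⟩
        Σ Cl (λ cs → Σ Pl (λ p → ind (A cs) (ind (B p) (S cs p))))
          ≈⟨ Σ-swap Cl Pl _ ⟩
        Σ Pl (λ p → Σ Cl (λ cs → ind (A cs) (ind (B p) (S cs p))))
          ≈⟨ Σ-cong Pl (λ p → trans (Σ-cong Cl (λ cs → reflexive (ind-comm (A cs) (B p) _)))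
                                    (sym (ind-Σ (B p) Cl _))) ⟩
        Σ Pl (λ p → ind (B p) (Σ Cl (λ cs → ind (A cs) (S cs p))))
          ≈⟨ Σ-cong Pl (λ p → ind-cong (B p) (λ _ → sym (annSum-Σ-ind id p w Cl A (attachedValue es)))) ⟩
        Σ Pl (λ p → ind (B p) (annSum id p w (attachedSum es))) ∎
        where
        Cl = attachments Pl es 0
        A : List ℕ → Bool
        A cs = respects χ es cs 0
        B : ℕ → Bool
        B p = χ (length es) ≡ᵇ χ p
        S : List ℕ → ℕ → Carrier
        S cs p = annSum id p w (attachedValue es cs)
        last-step : ∀ cs p → length cs ≡.≡ length es →
          ind (respects χ (es ++ star ∷ []) (cs ++ p ∷ []) 0) (attachedValue (es ++ star ∷ []) (cs ++ p ∷ []) w)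
            ≈ ind (A cs) (ind (B p) (S cs p))
        last-step cs p lcs = begin
          ind (respects χ (es ++ star ∷ []) (cs ++ p ∷ []) 0) (attachedValue (es ++ star ∷ []) (cs ++ p ∷ []) w)
            ≡⟨ ≡.cong₂ ind (respects-∷ʳ χ es cs star p 0 lcs)
                 (≡.cong (λ ws → expect ws (basis w)) (coloredWord-∷ʳ cs es p star lcs)) ⟩
          ind (A cs ∧ B p) (expect (coloredWord cs es ++ ann p ∷ []) (basis w))
            ≈⟨ ind-cong (A cs ∧ B p) (λ _ → trans (expect-ann (coloredWord cs es) p w)
                 (reflexive (≡.cong (λ z → Σ z (λ r → proj₁ r * attachedValue es cs (proj₂ r)))
                                    (annW-annPreimage p w)))) ⟩
          ind (A cs ∧ B p) (S cs p)
            ≡⟨ ≡.sym (ind-∧ (A cs) (B p) _) ⟩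
          ind (A cs) (ind (B p) (S cs p)) ∎

      attachedSum-∷ʳ-pow : ∀ es m w →
        attachedSum (es ++ pow m ∷ []) w ≈ attachedSum es (replicate m (length es) ++ w)
      attachedSum-∷ʳ-pow es m w = begin
        attachedSum (es ++ pow m ∷ []) w
          ≈⟨ Σ-attachments-∷ʳ Pl es (pow m) 0 _ ⟩
        Σ Cl (λ cs → ind (respects χ (es ++ pow m ∷ []) (cs ++ j ∷ []) 0)
                         (attachedValue (es ++ pow m ∷ []) (cs ++ j ∷ []) w) + 0#)
          ≈⟨ Σ-cong-local Cl (All.map (λ {cs} lcs → trans (+-identityʳ _) (reflexive (last-step cs lcs)))
               (attachments-length Pl es 0)) ⟩
        attachedSum es (replicate m j ++ w) ∎
        where
        Cl = attachments Pl es 0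
        j = length es
        last-step : ∀ cs → length cs ≡.≡ length es →
          ind (respects χ (es ++ pow m ∷ []) (cs ++ j ∷ []) 0) (attachedValue (es ++ pow m ∷ []) (cs ++ j ∷ []) w)
            ≡.≡ ind (respects χ es cs 0) (attachedValue es cs (replicate m j ++ w))
        last-step cs lcs = ≡.cong₂ ind
          (≡.trans (respects-∷ʳ χ es cs (pow m) j 0 lcs) (∧-identityʳ _))
          (≡.cong vac (≡.trans (≡.cong (λ ws → applyWord ws (basis w)) (coloredWord-∷ʳ cs es j (pow m) lcs))
            (≡.trans (applyWord-++ (coloredWord cs es) (replicate m (cre j)) _)
              (≡.cong (applyWord (coloredWord cs es)) (applyWord-replicate-cre m j 1# w)))))

    -- Wick-type expansion: an annihilator can only remove a factor created at a power position of its colour.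
    wick : ∀ {es} → Reverse es → PowersIn Pl es 0 → ∀ w → All (_∈ Pl) w →
      expect (W es) (basis (map χ w)) ≈ attachedSum es w
    wick [] _ []      _ = sym (+-identityʳ _)
    wick [] _ (d ∷ w) _ = sym (+-identityʳ _)
    wick (es ∶ rs ∶ʳ star) pows w w⊆Pl = begin
      expect (W (es ++ star ∷ [])) (basis (map χ w))
        ≡⟨ ≡.cong (λ ws → expect ws (basis (map χ w))) (coloredWord-applyUpTo-∷ʳ χ es star) ⟩
      expect (W es ++ ann (χ j) ∷ []) (basis (map χ w))
        ≈⟨ expect-ann (W es) (χ j) (map χ w) ⟩
      Σ (annW (χ j) (map χ w)) (λ r → proj₁ r * expect (W es) (basis (proj₂ r)))
        ≡⟨ ≡.cong (λ z → Σ z (λ r → proj₁ r * expect (W es) (basis (proj₂ r)))) (annW-map χ (χ j) w) ⟩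
      Σ (relabel χ (annPreimage χ (χ j) w)) (λ r → proj₁ r * expect (W es) (basis (proj₂ r)))
        ≡⟨ Σ-map _ (annPreimage χ (χ j) w) _ ⟩
      Σ (annPreimage χ (χ j) w) (λ r → proj₁ r * expect (W es) (basis (map χ (proj₂ r))))
        ≈⟨ Σ-cong-local (annPreimage χ (χ j) w)
             (All.map (λ {r} r⊆Pl → *-congˡ (wick rs pows′ (proj₂ r) r⊆Pl)) (annPreimage-⊆ χ (χ j) w w⊆Pl)) ⟩
      annSum χ (χ j) w (attachedSum es)
        ≈⟨ sym (Σ-annSum-colour (χ j) w w⊆Pl (attachedSum es)) ⟩
      Σ Pl (λ p → ind (χ j ≡ᵇ χ p) (annSum id p w (attachedSum es)))
        ≈⟨ sym (attachedSum-∷ʳ-star es w) ⟩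
      attachedSum (es ++ star ∷ []) w ∎
      where
      j = length es
      pows′ = proj₁ (PowersIn-∷ʳ Pl es star 0 pows)
    wick (es ∶ rs ∶ʳ pow m) pows w w⊆Pl = begin
      expect (W (es ++ pow m ∷ [])) (basis (map χ w))
        ≡⟨ ≡.cong (λ ws → expect ws (basis (map χ w))) (coloredWord-applyUpTo-∷ʳ χ es (pow m)) ⟩
      expect (W es ++ replicate m (cre (χ j))) (basis (map χ w))
        ≡⟨ ≡.cong vac (≡.trans (applyWord-++ (W es) (replicate m (cre (χ j))) _)
             (≡.cong (applyWord (W es)) (applyWord-replicate-cre m (χ j) 1# (map χ w)))) ⟩
      expect (W es) (basis (replicate m (χ j) ++ map χ w))
        ≡⟨ ≡.cong (λ u → expect (W es) (basis u))
             (≡.trans (≡.cong (_++ map χ w) (≡.sym (List.map-replicate χ m j)))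
                      (≡.sym (List.map-++ χ (replicate m j) w))) ⟩
      expect (W es) (basis (map χ (replicate m j ++ w)))
        ≈⟨ wick rs pows′ (replicate m j ++ w) (All.++⁺ (All.replicate⁺ m j∈Pl) w⊆Pl) ⟩
      attachedSum es (replicate m j ++ w)
        ≈⟨ sym (attachedSum-∷ʳ-pow es m w) ⟩
      attachedSum (es ++ pow m ∷ []) w ∎
      where
      j = length es
      pows′ = proj₁ (PowersIn-∷ʳ Pl es (pow m) 0 pows)
      j∈Pl = proj₂ (PowersIn-∷ʳ Pl es (pow m) 0 pows)

module LatticeWords where

  open import Data.Nat using (ℕ; zero; suc; _+_; _<_; _≤_; z≤n; s≤s)
  open import Data.Nat.Properties using (<-irrefl; +-identityʳ; +-suc)
  open import Data.Integer using (+_; -[1+_]; _⊖_) renaming (_≤_ to _≤ℤ_)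
  import Data.Integer.Properties as ℤ
  open import Data.List using (List; []; _∷_; _++_; map; concat; length; replicate; tails)
  import Data.List.Properties as List
  open import Data.List.Relation.Unary.All as All using (All; []; _∷_)
  open import Data.List.Membership.Propositional using (_∈_)
  open import Data.List.Relation.Unary.Any using (here; there)
  open import Data.Product using (_×_; _,_; ∃; ∃₂)
  open import Data.Empty using (⊥-elim)
  open import Relation.Binary.PropositionalEquality
  open import Relation.Nullary using (¬_)
  open Counting using (length-∷ʳ)
  open SetPartitions using (at)
  open Attachments using (powerPositions; powerPositions-≥; attachments; coloredWord)

  stars-then : ℕ → ℕ → List Eps
  stars-then a b = replicate a star ++ pow b ∷ []

  powerPositions-[] : ∀ es k → powerPositions es k ≡ [] → es ≡ replicate (length es) star
  powerPositions-[] []           k _ = refl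
  powerPositions-[] (star ∷ es)  k e = cong (star ∷_) (powerPositions-[] es (suc k) e)

  wsum-stars : ∀ a → wsum (replicate (suc a) star) ≡ -[1+ a ]
  wsum-stars zero    = refl
  wsum-stars (suc a) rewrite wsum-stars a = refl

  wsum-stars-then : ∀ a b → wsum (stars-then a b) ≡ b ⊖ a
  wsum-stars-then zero    b = trans (ℤ.+-identityʳ (+ b)) (sym (ℤ.⊖-≥ z≤n))
  wsum-stars-then (suc a) b rewrite wsum-stars-then a b = ℤ.distribʳ-⊖-+-neg 0 b a

  -- The suffix after the only power would consist of stars, and have negative weight.
  powerPositions-single : ∀ es k p → powerPositions es k ≡ p ∷ [] → All (λ t → + 0 ≤ℤ wsum t) (tails es) →
    ∃₂ λ a b → es ≡ stars-then a b
  powerPositions-single (star ∷ es) k p e (_ ∷ suffixes) =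
    let (a , b , es≡) = powerPositions-single es (suc k) p e suffixes in suc a , b , cong (star ∷_) es≡
  powerPositions-single (pow b ∷ [])      k p e _ = 0 , b , refl
  powerPositions-single (pow b ∷ e′ ∷ es) k p e (_ ∷ nonneg ∷ _)
    with subst (λ t → + 0 ≤ℤ wsum t) (powerPositions-[] (e′ ∷ es) (suc k) (List.∷-injectiveʳ e)) nonneg
  ... | nonneg′ rewrite wsum-stars (length es) with nonneg′
  ... | ()

  powerPositions-sorted : ∀ es k p rest → powerPositions es k ≡ p ∷ rest → All (p <_) rest
  powerPositions-sorted (star ∷ es)  k p  rest e    = powerPositions-sorted es (suc k) p rest e
  powerPositions-sorted (pow _ ∷ es) k .k ._   refl = powerPositions-≥ es (suc k)

  twoPowerPositions : ∀ es → 1 ≤ length es → LatticeWord es → ¬ (∃ λ m → es ≡ special m) →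
    ∃₂ λ p₁ p₂ → p₁ ∈ powerPositions es 0 × p₂ ∈ powerPositions es 0 × p₁ ≢ p₂
  twoPowerPositions es 1≤n (suffixes , balanced) not-special with powerPositions es 0 in eq
  ... | [] = ⊥-elim (no-stars-only (length es) 1≤n (trans (cong wsum (sym (powerPositions-[] es 0 eq))) balanced))
    where
    no-stars-only : ∀ n → 1 ≤ n → wsum (replicate n star) ≢ + 0
    no-stars-only (suc a) _ e with trans (sym (wsum-stars a)) e
    ... | ()
  ... | p ∷ [] =
    let (a , b , es≡) = powerPositions-single es 0 p eq suffixes
        b≡a = ℤ.+-injective (ℤ.i-j≡0⇒i≡j (+ b) (+ a)
                (trans (ℤ.[+m]-[+n]≡m⊖n b a) (trans (sym (wsum-stars-then a b)) (trans (cong wsum (sym es≡)) balanced))))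
    in ⊥-elim (not-special (a , trans es≡ (cong (stars-then a) b≡a)))
  ... | p₁ ∷ p₂ ∷ rest = p₁ , p₂ , here refl , there (here refl) ,
    (λ p₁≡p₂ → <-irrefl p₁≡p₂ (All.head (powerPositions-sorted es 0 p₁ (p₂ ∷ rest) eq)))

  powerPositions-stars-then : ∀ a b k → powerPositions (stars-then a b) k ≡ (k + a) ∷ []
  powerPositions-stars-then zero    b k rewrite +-identityʳ k = refl
  powerPositions-stars-then (suc a) b k rewrite powerPositions-stars-then a b (suc k) | +-suc k a = refl

  attachments-stars-then : ∀ p a b k → attachments (p ∷ []) (stars-then a b) k ≡ (replicate a p ++ (k + a) ∷ []) ∷ []
  attachments-stars-then p zero    b k rewrite +-identityʳ k = refl
  attachments-stars-then p (suc a) b k rewrite attachments-stars-then p a b (suc k) | +-suc k a = refl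

  coloredWord-stars-then : ∀ c a b →
    coloredWord (replicate a c ++ c ∷ []) (stars-then a b) ≡ replicate a (ann c) ++ (replicate b (cre c) ++ [])
  coloredWord-stars-then c zero    b = refl
  coloredWord-stars-then c (suc a) b = cong (ann c ∷_) (coloredWord-stars-then c a b)

  letters-stars-then : ∀ c a b →
    concat (map (letters c) (stars-then a b)) ≡ replicate a (ann c) ++ (replicate b (cre c) ++ [])
  letters-stars-then c zero    b = refl
  letters-stars-then c (suc a) b = cong (ann c ∷_) (letters-stars-then c a b)

  at-replicate : ∀ (c a i : ℕ) → i < suc a → at (replicate a c ++ c ∷ []) i ≡ c
  at-replicate c zero    zero    _         = refl
  at-replicate c zero    (suc i) (s≤s ())
  at-replicate c (suc a) zero    _         = refl
  at-replicate c (suc a) (suc i) (s≤s i≤a) = at-replicate c a i i≤a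

  length-stars-then : ∀ a b → length (stars-then a b) ≡ suc a
  length-stars-then a b = trans (length-∷ʳ (replicate a star) (pow b)) (cong suc (List.length-replicate a))

module Cumulants {c ℓ} (R : CommutativeRing c ℓ) (q : CommutativeRing.Carrier R) where

  open import Data.Nat using (ℕ; zero; suc; _<_; _≤_; _≡ᵇ_)
  open import Data.Nat.Properties using (≤-trans; m≤m+n)
  open import Data.Bool using (Bool; true; T; _∧_)
  open import Data.Bool.Properties using (T-≡; T-∧; ∧-identityʳ)
  open import Function.Bundles using (Equivalence)
  open import Data.List using (List; []; _∷_; _++_; map; concat; foldr; length; replicate; zipWith; applyUpTo; upTo)
  import Data.List.Properties as List
  open import Data.List.Relation.Unary.All as All using (All; []; _∷_)
  open import Data.List.Reverse using (reverseView)
  open import Data.Product using (_,_; proj₁; proj₂; ∃)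
  open import Data.List.Membership.Propositional using (_∈_)
  open import Function using (id)
  import Relation.Binary.PropositionalEquality as ≡
  open ≡ using (_≢_)
  open import Relation.Nullary using (¬_)
  open Booleans using (≡ᵇ-refl)
  open Counting using (length-∷ʳ)
  open SetPartitions
  open Attachments
  open LatticeWords

  open CommutativeRing R
  open Fock R q
  open RingSums R
  open FockLinearity R q
  open WickExpansion R q
  open import Relation.Binary.Reasoning.Setoid setoid

  at-top : ∀ n i → at (top n) i ≡.≡ 0
  at-top zero    i       = ≡.refl
  at-top (suc n) zero    = ≡.refl
  at-top (suc n) (suc i) = at-top n i

  top-length : ∀ n → length (top n) ≡.≡ n
  top-length n = List.length-replicate n

  refinesB-top : ∀ n σ → length σ ≡.≡ n → refinesB σ (top n) ≡.≡ true
  refinesB-top n σ lσ = Equivalence.to T-≡ (Finer⇒refinesB σ (top n) lσ (top-length n)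
    (λ i j _ _ _ → ≡.trans (at-top n i) (≡.sym (at-top n j))))

  coloredWord-zipWith : ∀ σ es → concat (zipWith (λ b e → letters (suc b) e) σ es) ≡.≡ coloredWord (map suc σ) es
  coloredWord-zipWith []      es       = ≡.refl
  coloredWord-zipWith (x ∷ σ) []       = ≡.refl
  coloredWord-zipWith (x ∷ σ) (e ∷ es) = ≡.cong (letters (suc x) e ++_) (coloredWord-zipWith σ es)

  applyUpTo-at : ∀ σ → applyUpTo (λ i → suc (at σ i)) (length σ) ≡.≡ map suc σ
  applyUpTo-at []      = ≡.refl
  applyUpTo-at (x ∷ σ) = ≡.cong (suc x ∷_) (applyUpTo-at σ)

  module _ (es : List Eps) where

    private
      n  = length es
      Πₙ = partitions n
      Pl = powerPositions es 0
      Cl = attachments Pl es 0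

    attachedWeight : List ℕ → Carrier
    attachedWeight cs = expect (coloredWord cs es) (basis [])

    ρπ-attachments : ∀ σ → length σ ≡.≡ n →
      ρπ σ es ≈ Σ Cl (λ cs → ind (refinesB cs σ) (attachedWeight cs))
    ρπ-attachments σ lσ = begin
      ρπ σ es
        ≡⟨ ≡.cong (λ ws → expect ws (basis [])) (≡.trans (coloredWord-zipWith σ es)
             (≡.cong (λ cs → coloredWord cs es)
               (≡.sym (≡.trans (≡.cong (applyUpTo χ) (≡.sym lσ)) (applyUpTo-at σ))))) ⟩
      expect (coloredWord (applyUpTo χ n) es) (basis (map χ []))
        ≈⟨ wick Pl (powerPositions-once es 0) χ (reverseView es) (PowersIn-⊇ es 0 Pl (λ _ p∈ → p∈)) [] [] ⟩
      Σ Cl (λ cs → ind (respects χ es cs 0) (attachedWeight cs))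
        ≈⟨ Σ-cong-local Cl (All.map (λ {cs} valid →
             reflexive (≡.cong (λ b → ind b (attachedWeight cs)) (respects-refinesB es cs valid σ lσ)))
             (attachments-valid Pl es 0)) ⟩
      Σ Cl (λ cs → ind (refinesB cs σ) (attachedWeight cs)) ∎
      where
      χ : ℕ → ℕ
      χ i = suc (at σ i)

    -- Möbius inversion collapses the sum over σ to the attachments whose blocks are all joined.
    K-attachments : K es ≈ Σ Cl (λ cs → attachedWeight cs * ind (eqPB cs (top n)) 1#)
    K-attachments = begin
      K es
        ≈⟨ Σ-cong-local Πₙ (All.map (λ {σ} lσ →
             reflexive (≡.cong (λ b → ind b (ρπ σ es * μ n Πₙ σ (top n))) (refinesB-top n σ lσ)))
             (partitions-length n)) ⟩
      Σ Πₙ (λ σ → ρπ σ es * μ n Πₙ σ (top n))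
        ≈⟨ Σ-cong-local Πₙ (All.map (λ {σ} lσ → *-congʳ (ρπ-attachments σ lσ)) (partitions-length n)) ⟩
      Σ Πₙ (λ σ → Σ Cl (λ cs → ind (refinesB cs σ) (attachedWeight cs)) * μ n Πₙ σ (top n))
        ≈⟨ Σ-cong-local Πₙ (All.map (λ {σ} lσ →
             trans (sym (Σ-distribʳ Cl _ _)) (Σ-cong Cl (λ cs → swap-ind σ lσ cs)))
             (partitions-length n)) ⟩
      Σ Πₙ (λ σ → Σ Cl (λ cs → attachedWeight cs * ind (refinesB cs σ ∧ refinesB σ (top n)) (μ n Πₙ σ (top n))))
        ≈⟨ Σ-swap Πₙ Cl _ ⟩
      Σ Cl (λ cs → Σ Πₙ (λ σ → attachedWeight cs * ind (refinesB cs σ ∧ refinesB σ (top n)) (μ n Πₙ σ (top n))))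
        ≈⟨ Σ-cong-local Cl (All.map (λ {cs} valid → trans (Σ-distribˡ Πₙ (attachedWeight cs) _) (*-congˡ
             (Σ-interval-μ n cs (top n) (proj₁ valid) (top-length n) (≤-trans (blockCount-≤ n (at cs)) (m≤m+n n _)))))
             (attachments-valid Pl es 0)) ⟩
      Σ Cl (λ cs → attachedWeight cs * ind (eqPB cs (top n)) 1#) ∎
      where
      open MöbiusInversion R q n using (Σ-interval-μ)
      swap-ind : ∀ σ → length σ ≡.≡ n → ∀ cs →
        ind (refinesB cs σ) (attachedWeight cs) * μ n Πₙ σ (top n)
          ≈ attachedWeight cs * ind (refinesB cs σ ∧ refinesB σ (top n)) (μ n Πₙ σ (top n))
      swap-ind σ lσ cs = trans (ind-*-swap (refinesB cs σ) (attachedWeight cs) _)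
        (*-congˡ (reflexive (≡.trans
          (≡.cong (λ b → ind b (μ n Πₙ σ (top n))) (≡.sym (∧-identityʳ (refinesB cs σ))))
          (≡.cong (λ b → ind (refinesB cs σ ∧ b) (μ n Πₙ σ (top n))) (≡.sym (refinesB-top n σ lσ))))))

    -- Two distinct powers are attached to themselves, so no attachment joins all positions.
    not-connected : ∀ cs → IsAttachment Pl es 0 cs → ∀ {p₁ p₂} → p₁ ∈ Pl → p₂ ∈ Pl → p₁ ≢ p₂ →
      ¬ T (eqPB cs (top n))
    not-connected cs valid p₁∈ p₂∈ p₁≢p₂ t =
      let (i₁ , p₁≡i₁ , i₁<n , b₁ , eb₁) = ∈-powerPositions⁻ es 0 _ p₁∈
          (i₂ , p₂≡i₂ , i₂<n , b₂ , eb₂) = ∈-powerPositions⁻ es 0 _ p₂∈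
          top⊑cs = refinesB⇒Finer (top n) cs (top-length n) (proj₁ valid) (proj₂ (Equivalence.to T-∧ t))
          cs-i₁ = proj₂ (proj₂ valid i₁ i₁<n) b₁ eb₁
          cs-i₂ = proj₂ (proj₂ valid i₂ i₂<n) b₂ eb₂
      in p₁≢p₂ (≡.trans p₁≡i₁ (≡.trans (≡.sym cs-i₁)
           (≡.trans (top⊑cs i₁ i₂ i₁<n i₂<n (≡.trans (at-top n i₁) (≡.sym (at-top n i₂))))
              (≡.trans cs-i₂ (≡.sym p₂≡i₂)))))

    K-non-special : 1 ≤ n → LatticeWord es → ¬ (∃ λ m → es ≡.≡ special m) → K es ≈ 0#
    K-non-special 1≤n lattice not-special =
      let (p₁ , p₂ , p₁∈ , p₂∈ , p₁≢p₂) = twoPowerPositions es 1≤n lattice not-special in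
      trans K-attachments (Σ-zero Cl _ (All.map (λ {cs} valid →
        trans (*-congˡ (reflexive (ind-false _ 1# (not-connected cs valid p₁∈ p₂∈ p₁≢p₂)))) (zeroʳ _))
        (attachments-valid Pl es 0)))

  -- The only attachment of the stars sends them all to the final power, which joins all positions.
  K-special : ∀ m → K (special m) ≈ ρ (replicate m (ann m) ++ (replicate m (cre m) ++ []))
  K-special m = begin
    K (special m)
      ≈⟨ K-attachments (special m) ⟩
    Σ (attachments (powerPositions (special m) 0) (special m) 0) F
      ≡⟨ ≡.cong (λ Pl → Σ (attachments Pl (special m) 0) F) (powerPositions-stars-then m m 0) ⟩
    Σ (attachments (m ∷ []) (special m) 0) F
      ≡⟨ ≡.cong (λ Cl → Σ Cl F) (attachments-stars-then m m m 0) ⟩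
    F cs₀ + 0#
      ≈⟨ +-identityʳ _ ⟩
    attachedWeight (special m) cs₀ * ind (eqPB cs₀ (top n)) 1#
      ≡⟨ ≡.cong (λ b → attachedWeight (special m) cs₀ * ind b 1#) connected ⟩
    attachedWeight (special m) cs₀ * 1#
      ≈⟨ *-identityʳ _ ⟩
    attachedWeight (special m) cs₀
      ≡⟨ ≡.cong (λ ws → expect ws (basis [])) (coloredWord-stars-then m m m) ⟩
    ρ (replicate m (ann m) ++ (replicate m (cre m) ++ [])) ∎
    where
    n = length (special m)
    cs₀ = replicate m m ++ m ∷ []
    F : List ℕ → Carrier
    F cs = attachedWeight (special m) cs * ind (eqPB cs (top n)) 1#
    lcs₀ : length cs₀ ≡.≡ n
    lcs₀ = ≡.trans (length-∷ʳ (replicate m m) m)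
             (≡.trans (≡.cong suc (List.length-replicate m)) (≡.sym (length-stars-then m m)))
    connected : eqPB cs₀ (top n) ≡.≡ true
    connected = Equivalence.to T-≡ (SameBlocks⇒eqPB cs₀ (top n) lcs₀ (top-length n)
      ((λ i j _ _ _ → ≡.trans (at-top n i) (≡.sym (at-top n j))) ,
       (λ i j i<n j<n _ → ≡.trans (at-replicate m m i (≡.subst (i <_) (length-stars-then m m) i<n))
                                  (≡.sym (at-replicate m m j (≡.subst (j <_) (length-stars-then m m) j<n))))))

  qint-suc : ∀ k → qint (suc k) ≈ 1# + q * qint k
  qint-suc k = +-congˡ (begin
    foldr _+_ 0# (map qpow (applyUpTo suc k)) ≡⟨ ≡.cong (λ is → Σ is qpow) (≡.sym (List.map-applyUpTo id suc k)) ⟩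
    Σ (map suc (upTo k)) qpow                   ≡⟨ Σ-map suc (upTo k) qpow ⟩
    Σ (upTo k) (λ i → q * qpow i)               ≈⟨ Σ-distribˡ (upTo k) q qpow ⟩
    q * qint k                                  ∎)

  -- Removing one of k+1 equal factors: the j-th one contributes q^j.
  annSum-replicate : ∀ c k (H : List ℕ → Carrier) →
    annSum id c (replicate (suc k) c) H ≈ qint (suc k) * H (replicate k c)
  annSum-replicate c zero H = begin
    annSum id c (c ∷ []) H    ≈⟨ annSum-∷ id c c [] H ⟩
    ind (c ≡ᵇ c) (H []) + q * 0# ≡⟨ ≡.cong (λ b → ind b (H []) + q * 0#) (≡ᵇ-refl c) ⟩
    H [] + q * 0#             ≈⟨ trans (+-congˡ (zeroʳ q)) (+-identityʳ _) ⟩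
    H []                      ≈⟨ sym (*-identityˡ _) ⟩
    1# * H []                 ≈⟨ *-congʳ (sym (+-identityʳ 1#)) ⟩
    qint 1 * H []             ∎
  annSum-replicate c (suc k) H = begin
    annSum id c (c ∷ replicate (suc k) c) H
      ≈⟨ annSum-∷ id c c (replicate (suc k) c) H ⟩
    ind (c ≡ᵇ c) X + q * annSum id c (replicate (suc k) c) (λ u → H (c ∷ u))
      ≡⟨ ≡.cong (λ b → ind b X + q * annSum id c (replicate (suc k) c) (λ u → H (c ∷ u))) (≡ᵇ-refl c) ⟩
    X + q * annSum id c (replicate (suc k) c) (λ u → H (c ∷ u))
      ≈⟨ +-congˡ (*-congˡ (annSum-replicate c k (λ u → H (c ∷ u)))) ⟩
    X + q * (qint (suc k) * X)       ≈⟨ +-cong (sym (*-identityˡ X)) (sym (*-assoc q _ X)) ⟩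
    1# * X + (q * qint (suc k)) * X  ≈⟨ sym (distribʳ X 1# _) ⟩
    (1# + q * qint (suc k)) * X      ≈⟨ *-congʳ (sym (qint-suc (suc k))) ⟩
    qint (suc (suc k)) * X           ∎
    where
    X = H (replicate (suc k) c)

  expect-annihilate-all : ∀ c k → expect (replicate k (ann c)) (basis (replicate k c)) ≈ qfact k
  expect-annihilate-all c zero    = +-identityʳ 1#
  expect-annihilate-all c (suc k) = begin
    expect (replicate (suc k) (ann c)) (basis (replicate (suc k) c))
      ≡⟨ ≡.cong (λ ws → expect ws (basis (replicate (suc k) c))) (replicate-∷ʳ (ann c) k) ⟩
    expect (replicate k (ann c) ++ ann c ∷ []) (basis (replicate (suc k) c))
      ≈⟨ expect-ann (replicate k (ann c)) c (replicate (suc k) c) ⟩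
    Σ (annW c (replicate (suc k) c)) (λ r → proj₁ r * expect (replicate k (ann c)) (basis (proj₂ r)))
      ≡⟨ ≡.cong (λ z → Σ z (λ r → proj₁ r * expect (replicate k (ann c)) (basis (proj₂ r))))
           (annW-annPreimage c (replicate (suc k) c)) ⟩
    annSum id c (replicate (suc k) c) (λ u → expect (replicate k (ann c)) (basis u))
      ≈⟨ annSum-replicate c k _ ⟩
    qint (suc k) * expect (replicate k (ann c)) (basis (replicate k c))
      ≈⟨ *-congˡ (expect-annihilate-all c k) ⟩
    qint (suc k) * qfact k
      ≈⟨ *-comm _ _ ⟩
    qfact (suc k) ∎
    where
    replicate-∷ʳ : ∀ {A : Set} (x : A) k → replicate (suc k) x ≡.≡ replicate k x ++ x ∷ []
    replicate-∷ʳ x zero    = ≡.refl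
    replicate-∷ʳ x (suc k) = ≡.cong (x ∷_) (replicate-∷ʳ x k)

  ρ-ann-cre : ∀ c m → ρ (replicate m (ann c) ++ (replicate m (cre c) ++ [])) ≈ qfact m
  ρ-ann-cre c m = begin
    vac (applyWord (replicate m (ann c) ++ (replicate m (cre c) ++ [])) (basis []))
      ≡⟨ ≡.cong vac (≡.trans (applyWord-++ (replicate m (ann c)) _ _) (≡.cong (applyWord (replicate m (ann c)))
           (≡.trans (applyWord-++ (replicate m (cre c)) [] _) (applyWord-replicate-cre m c 1# [])))) ⟩
    expect (replicate m (ann c)) (basis (replicate m c ++ []))
      ≡⟨ ≡.cong (λ u → expect (replicate m (ann c)) (basis u)) (List.++-identityʳ _) ⟩
    expect (replicate m (ann c)) (basis (replicate m c))
      ≈⟨ expect-annihilate-all c m ⟩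
    qfact m ∎

  ρword-special : ∀ m → ρword (special m) ≈ qfact m
  ρword-special m = trans (reflexive (≡.cong ρ (letters-stars-then 0 m m))) (ρ-ann-cre 0 m)

mainTheorem8 : ∀ {c ℓ : Level} (R : CommutativeRing c ℓ) (q : CommutativeRing.Carrier R) →
    ((es : List Eps) → 1 ≤ length es → LatticeWord es → ¬ (∃ λ m → es ≡ special m) →
      CommutativeRing._≈_ R (Fock.K R q es) (CommutativeRing.0# R))
    × ((m : ℕ) →
      CommutativeRing._≈_ R (Fock.K R q (special m)) (Fock.ρword R q (special m))
      × CommutativeRing._≈_ R (Fock.ρword R q (special m)) (Fock.qfact R q m))
mainTheorem8 R q =
  K-non-special ,
  λ m → trans (K-special m) (trans (ρ-ann-cre m m) (sym (ρword-special m))) , ρword-special m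
  where
  open CommutativeRing R using (trans; sym)
  open Cumulants R q
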